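{- Let $T_{\varepsilon_\mu}$ and $T'_{\varepsilon_\mu}$ be two simple colored triangulations with coloring $\varepsilon_\mu$. Then $T_{\varepsilon_\mu}$ and $T'_{\varepsilon_\mu}$ differ by a switched flip if and only if there exist a reading $w$ of $T_{\varepsilon_\mu}$ and a reading $w'$ of $T'_{\varepsilon_\mu}$ of the form $w=uxzv$, $w'=uzxv$, where $x\neq z$ are letters of $\mathcal{C}$ and $u,v$ are words on $\mathcal{C}$ such that $v$ contains no letter $y$ with $x\leq y<z$ or $z\leq y<x$.
   Context: $\mathcal{C}=\{c_1<\dots<c_p\}$ is a totally ordered set of colors, $\mu\in\mathbb{N}^p$ with $\sum\mu_k=n$, $\mathcal{C}_{n,\mu}$ the set of words of length $n$ on $\mathcal{C}$ with $\mu_k$ occurrences of $c_k$. $X=\{x_1<\dots<x_n\}$ are positive integers, $\widehat{X}=X\cup\{0,\infty\}$ ordered $0<x_1<\dots<x_n<\infty$, and $P$ is a convex $(n+2)$-gon labelled by $\widehat{X}$ clockwise increasingly; faces of a triangulation are labelled by their middle vertex. For a permutation $\sigma=x_{i_1}\cdots x_{i_n}$ of $X$ (as a word), $\varphi(\sigma)$ is the triangulation whose diagonals are, for $k=1,\dots,n-1$, the segments joining the predecessor and successor of $x_{i_k}$ in $\widehat{X}\setminus\{x_{i_1},\dots,x_{i_{k-1}}\}$. $\mathrm{std}(w)$ replaces the occurrences of $c_1$ in $w$ (left to right) by $x_1,\dots,x_{\mu_1}$, then those of $c_2$ by $x_{\mu_1+1},\dots$, etc. $\varepsilon_\mu$ consists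 of $\mu_1$ copies of $c_1$, then $\mu_2$ copies of $c_2$, etc. $T_{\varepsilon_\mu}$ denotes $T$ with vertex $x_i$ and the face labelled $x_i$ colored by the $i$-th entry of $\varepsilon_\mu$; it is simple if no diagonal joins two vertices of the same color and whenever $x_i,x_{i+1}$ have the same color, the third vertex $t_i$ of the face containing side $\{x_i,x_{i+1}\}$ satisfies $t_i<x_i$. $\Phi(w)$, for $w\in\mathcal{C}_{n,\mu}$, is $T_{\varepsilon_\mu}$ with $T=\varphi(\mathrm{std}(w))$; a reading of $T_{\varepsilon_\mu}$ is a word $w\in\mathcal{C}_{n,\mu}$ with $\Phi(w)=T_{\varepsilon_\mu}$. A switched flip is a diagonal flip (replacing a diagonal $d$ by the other diagonal of the quadrilateral formed by its two adjacent faces) that keeps the vertex colors and such that the two faces adjacent to $d$ have different colors. -}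

module Defs where

open import Data.Nat using (ℕ; zero; suc; _+_; _∸_; _≤_; _<_; _≡ᵇ_)
open import Data.Bool using (Bool; true; false; if_then_else_)
open import Data.Fin as F using (Fin; toℕ)
open import Data.Fin.Properties using (_≟_)
open import Data.List using (List; []; _∷_; take; length)
open import Data.Nat.ListAction using (sum)
open import Data.Bool.ListAction using (any)
open import Data.List.Membership.Propositional using (_∈_)
open import Data.Vec as V using (Vec)
open import Data.Maybe using (Maybe; just; nothing)
open import Data.Product using (_×_; _,_; ∃; ∃-syntax; Σ)
open import Data.Sum using (_⊎_)
open import Relation.Binary.PropositionalEquality using (_≡_; _≢_)
open import Relation.Nullary using (¬_; does)

-- Colors C = {c_1 < ... < c_p} are Fin p with its usual order.
-- μ : Vec ℕ p, n = sum μ.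
-- The vertices 0 < x_1 < ... < x_n < ∞ of the polygon P are encoded by
-- their positions 0, 1, ..., n, n+1 (order isomorphism; all notions
-- involved only depend on the order of X̂).
-- A diagonal / edge is an ordered pair (a , b) with a < b.
-- A set of diagonals is a List (ℕ × ℕ), considered up to membership.

Pair : Set
Pair = ℕ × ℕ

DiagSet : Set
DiagSet = List Pair

_≈ˢ_ : DiagSet → DiagSet → Set
D ≈ˢ D' = ∀ e → (e ∈ D → e ∈ D') × (e ∈ D' → e ∈ D)

IsDiag : ℕ → Pair → Set
IsDiag n (a , b) = suc a < b × b ≤ suc n × ¬ (a ≡ 0 × b ≡ suc n)

Cross : Pair → Pair → Set
Cross (a , b) (c , d) = (a < c × c < b × b < d) ⊎ (c < a × a < d × d < b)

IsTriangulation : ℕ → DiagSet → Set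
IsTriangulation n T =
  (∀ e → e ∈ T → IsDiag n e) ×
  (∀ e f → e ∈ T → f ∈ T → ¬ Cross e f) ×
  (∀ e → IsDiag n e → (∀ f → f ∈ T → ¬ Cross e f) → e ∈ T)

Edge : ℕ → DiagSet → ℕ → ℕ → Set
Edge n T a b = (b ≡ suc a) ⊎ (a ≡ 0 × b ≡ suc n) ⊎ ((a , b) ∈ T)

-- a < b < c is a face (triangle) of T; it is labelled by b
Face : ℕ → DiagSet → ℕ → ℕ → ℕ → Set
Face n T a b c = a < b × b < c × Edge n T a b × Edge n T b c × Edge n T a c

nth : {A : Set} → List A → ℕ → Maybe A
nth [] _ = nothing
nth (x ∷ xs) zero = just x
nth (x ∷ xs) (suc i) = nth xs i

replicateL : {A : Set} → ℕ → A → List A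
replicateL zero a = []
replicateL (suc k) a = a ∷ replicateL k a

εAux : ∀ {p q} → (Fin q → Fin p) → Vec ℕ q → List (Fin p)
εAux f V.[] = []
εAux f (m V.∷ μ) = Data.List._++_ (replicateL m (f F.zero)) (εAux (λ i → f (F.suc i)) μ)

εμ : ∀ {p} → Vec ℕ p → List (Fin p)
εμ μ = εAux (λ i → i) μ

-- color of the vertex at position i (and of the face labelled x_i);
-- the vertices 0 and ∞ are uncolored (nothing)
col : ∀ {p} → Vec ℕ p → ℕ → Maybe (Fin p)
col μ zero = nothing
col μ (suc i) = nth (εμ μ) i

IsSimple : ∀ {p} → Vec ℕ p → DiagSet → Set
IsSimple μ T =
  (∀ a b k → (a , b) ∈ T → col μ a ≡ just k → ¬ (col μ b ≡ just k)) ×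
  (∀ i → 1 ≤ i → i < n → col μ i ≡ col μ (suc i) →
     ∀ t → (Face n T t i (suc i) ⊎ Face n T i (suc i) t) → t < i)
  where n = sum (V.toList μ)

-- For q1 < q2 < q3 < q4, flipping the diagonal (q1,q3) of the quadrilateral
-- q1 q2 q3 q4 gives (q2,q4) and vice versa; in both cases the two faces
-- adjacent to the flipped diagonal are labelled q2 and q3.
Replace : DiagSet → Pair → Pair → DiagSet → Set
Replace T d d' T' = ∀ e → (e ∈ T' → e ≡ d' ⊎ (e ∈ T × e ≢ d)) ×
                          (e ≡ d' ⊎ (e ∈ T × e ≢ d) → e ∈ T')

SwitchedFlip : ∀ {p} → Vec ℕ p → DiagSet → DiagSet → Set
SwitchedFlip μ T T' =
  ∃[ q1 ] ∃[ q2 ] ∃[ q3 ] ∃[ q4 ]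
    (q1 < q2 × q2 < q3 × q3 < q4 ×
     col μ q2 ≢ col μ q3 ×
     ( ((q1 , q3) ∈ T × Face n T q1 q2 q3 × Face n T q1 q3 q4 ×
        Replace T (q1 , q3) (q2 , q4) T')
     ⊎ ((q2 , q4) ∈ T × Face n T q1 q2 q4 × Face n T q2 q3 q4 ×
        Replace T (q2 , q4) (q1 , q3) T')))
  where n = sum (V.toList μ)

count : ∀ {p} → Fin p → List (Fin p) → ℕ
count c [] = 0
count c (d ∷ w) = if does (c ≟ d) then suc (count c w) else count c w

InC : ∀ {p} → Vec ℕ p → List (Fin p) → Set
InC μ w = ∀ k → count k w ≡ V.lookup μ k

offset : ∀ {p} → Vec ℕ p → Fin p → ℕ
offset μ k = sum (take (toℕ k) (V.toList μ))

-- std(w), as a word of positions in 1..n: the j-th occurrence of c_k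
-- becomes x_{μ_1+...+μ_{k-1}+j}
stdAux : ∀ {p} → Vec ℕ p → List (Fin p) → List (Fin p) → List ℕ
stdAux μ seen [] = []
stdAux μ seen (c ∷ r) = (offset μ c + suc (count c seen)) ∷ stdAux μ (c ∷ seen) r

std : ∀ {p} → Vec ℕ p → List (Fin p) → List ℕ
std μ w = stdAux μ [] w

elem : ℕ → List ℕ → Bool
elem y R = any (λ r → r ≡ᵇ y) R

-- predecessor of (y+1) in X̂ ∖ R, searching downwards from y (0 ∉ R)
predR : List ℕ → ℕ → ℕ
predR R zero = 0
predR R (suc y) = if elem (suc y) R then predR R y else suc y

-- successor: first y, y+1, ... not in R; with fuel f the search ends at y+f
succR : List ℕ → ℕ → ℕ → ℕ
succR R y zero = y
succR R y (suc f) = if elem y R then succR R (suc y) f else y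

-- diagonals of φ(σ), σ a word of positions in 1..n; R = already removed
phiAux : ℕ → List ℕ → List ℕ → DiagSet
phiAux n R [] = []
phiAux n R (x ∷ []) = []
phiAux n R (x ∷ y ∷ r) =
  (predR R (x ∸ 1) , succR R (suc x) (n ∸ x)) ∷ phiAux n (x ∷ R) (y ∷ r)

φ : ℕ → List ℕ → DiagSet
φ n σ = phiAux n [] σ

-- w is a reading of T_{ε_μ}: w ∈ C_{n,μ} and Φ(w) = T_{ε_μ}
-- (the coloring ε_μ being fixed, this is φ(std w) = T)
IsReading : ∀ {p} → Vec ℕ p → DiagSet → List (Fin p) → Set
IsReading μ T w = InC μ w × (φ (sum (V.toList μ)) (std μ w) ≈ˢ T)

size : ∀ {p} → Vec ℕ p → ℕ
size μ = sum (V.toList μ)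

{-# OPTIONS --safe #-}
-- A reading σ of T removes x₁ … xₙ one at a time, and removing a vertex contributes the
-- diagonal joining its two current neighbours.  Let a < b be adjacent in σ with every vertex
-- strictly between them already removed, and let α, β be the nearest vertices still present
-- below a and above b.  Reading a then b contributes (α , b) and (α , β); reading b then a
-- contributes (a , β) and (α , β); nothing else changes.  So transposing a and b is the flip of
-- the diagonal of the quadrilateral α a b β, and it is switched when a and b have different
-- colours.  In std (u x z v) the letters x, z become such a pair as soon as no letter of v has
-- a colour in the interval between x and z.
-- Conversely, for a switched flip of the quadrilateral q₁ q₂ q₃ q₄, read T below each edge
-- recursively with the apex of its triangle last, arranged so that q₂ q₃ come right after
-- everything inside the quadrilateral.  Simplicity makes the vertices of each colour appear
-- in increasing order, so this reading is the standardisation of its colour word, and it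
-- forces the vertices read after q₃ to have colours outside the interval between q₂ and q₃.
module Submission where

open import Defs
open import Data.Bool using (true; false; _∨_; if_then_else_)
open import Data.Bool.Properties using (T-≡; ∨-assoc; ∨-comm)
open import Data.Empty using (⊥; ⊥-elim)
open import Data.Fin using (Fin; zero; suc) renaming (_<_ to _<ᶠ_; _≤_ to _≤ᶠ_)
import Data.Fin.Properties as FP
open FP using () renaming (_≟_ to _≟ᶠ_)
open import Data.List using (List; []; _∷_; _++_; _ʳ++_; length; map; initLast; _∷ʳ′_)
open import Data.List.Properties using (++-identityʳ; ++-assoc; ++-ʳ++; ∷-injectiveˡ; ∷-injectiveʳ; map-++; length-map)
open import Data.List.Membership.Propositional using (_∈_; _∉_)
open import Data.List.Membership.Propositional.Properties using (∈-++⁺ˡ; ∈-++⁺ʳ; ∈-++⁻)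
open import Data.List.Relation.Unary.All as All using (All)
open import Data.List.Relation.Unary.All.Properties using (All¬⇒¬Any; ¬Any⇒All¬) renaming (map⁺ to All-map⁺)
open import Data.List.Relation.Unary.AllPairs using ([]; _∷_)
open import Data.List.Relation.Unary.Any as Any using (Any; here; there; any?)
open import Data.List.Relation.Unary.Any.Properties using (any⁺; any⁻; reverseAcc⁺; reverseAcc⁻)
open import Data.List.Relation.Unary.Unique.Propositional using (Unique)
import Data.List.Relation.Unary.Unique.Propositional.Properties as Unique
open import Data.Maybe using (just; fromMaybe)
open import Data.Maybe.Properties using (just-injective)
open import Data.Nat using (ℕ; zero; suc; _+_; _∸_; _≤_; _<_; _≡ᵇ_; z≤n; s≤s; _<?_; _≤?_; _≟_)
open import Data.Nat.Induction using (<-wellFounded)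
open import Data.Nat.Properties
open import Data.Product using (_×_; _,_; proj₁; proj₂; ∃; ∃₂; ∃-syntax)
import Data.Product as Product
open import Data.Product.Properties using (≡-dec)
open import Data.Sum using (_⊎_; inj₁; inj₂; [_,_]′)
import Data.Sum as Sum
open import Data.Vec using (Vec; lookup) renaming (_∷_ to _∷ᵛ_)
open import Function using (_∘_)
open import Function.Bundles using (Equivalence)
open import Induction.WellFounded using (Acc; acc)
open import Relation.Binary.Definitions using (tri<; tri≈; tri>)
open import Relation.Binary.PropositionalEquality
open import Relation.Nullary using (¬_; Dec; yes; no; contradiction)
open import Relation.Nullary.Decidable using (_×-dec_; _⊎-dec_)

-- Removal orders and their diagonals

elem-∈ : ∀ {y} R → elem y R ≡ true → y ∈ R
elem-∈ R e = Any.map (λ {r} t → sym (≡ᵇ⇒≡ r _ t)) (any⁻ _ R (Equivalence.from T-≡ e))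

∈-elem : ∀ {y} R → y ∈ R → elem y R ≡ true
∈-elem {y} R y∈R = Equivalence.to T-≡ (any⁺ _ (Any.map (λ { refl → ≡⇒≡ᵇ y y refl }) y∈R))

∈-ʳ++⁻ : ∀ {X : Set} {γ : X} (A R : List X) → γ ∈ A ʳ++ R → γ ∈ A ⊎ γ ∈ R
∈-ʳ++⁻ A R m = Sum.swap (reverseAcc⁻ R A m)

∈-ʳ++⁺ : ∀ {X : Set} {γ : X} (A R : List X) → γ ∈ A ⊎ γ ∈ R → γ ∈ A ʳ++ R
∈-ʳ++⁺ A R m = reverseAcc⁺ R A (Sum.swap m)

Between : ℕ → ℕ → ℕ → Set
Between α β γ = α < γ × γ < β

-- predR stops at 0 and succR at y + f whether or not these are removed.
record LastKept (R : List ℕ) (y α : ℕ) : Set where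
  field
    α≤y     : α ≤ y
    kept    : α ≡ 0 ⊎ α ∉ R
    removed : ∀ γ → α < γ → γ ≤ y → γ ∈ R

record FirstKept (R : List ℕ) (y f β : ℕ) : Set where
  field
    y≤β     : y ≤ β
    β≤y+f   : β ≤ y + f
    kept    : β ≡ y + f ⊎ β ∉ R
    removed : ∀ γ → y ≤ γ → γ < β → γ ∈ R

predR-lastKept : ∀ R y → LastKept R y (predR R y)
predR-lastKept R zero = record
  { α≤y = z≤n ; kept = inj₁ refl ; removed = λ _ α<γ γ≤0 → contradiction γ≤0 (<⇒≱ α<γ) }
predR-lastKept R (suc y) with elem (suc y) R in e
... | true  = record { α≤y = m≤n⇒m≤1+n α≤y ; kept = kept ; removed = removed′ }
  where
  open LastKept (predR-lastKept R y)
  removed′ : ∀ γ → predR R y < γ → γ ≤ suc y → γ ∈ R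
  removed′ γ α<γ γ≤1+y with m≤n⇒m<n∨m≡n γ≤1+y
  ... | inj₁ γ<1+y = removed γ α<γ (≤-pred γ<1+y)
  ... | inj₂ refl  = elem-∈ R e
... | false = record
  { α≤y = ≤-refl ; kept = inj₂ (λ m → contradiction (trans (sym (∈-elem R m)) e) λ ())
  ; removed = λ _ α<γ γ≤α → contradiction γ≤α (<⇒≱ α<γ) }

succR-firstKept : ∀ R f y → FirstKept R y f (succR R y f)
succR-firstKept R zero y = record
  { y≤β = ≤-refl ; β≤y+f = m≤m+n y 0 ; kept = inj₁ (sym (+-identityʳ y))
  ; removed = λ _ y≤γ γ<y → contradiction y≤γ (<⇒≱ γ<y) }
succR-firstKept R (suc f) y with elem y R in e
... | true  = record
  { y≤β = ≤-trans (n≤1+n y) y≤β ; β≤y+f = ≤-trans β≤y+f (≤-reflexive (sym (+-suc y f)))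
  ; kept = Sum.map₁ (λ eq → trans eq (sym (+-suc y f))) kept ; removed = removed′ }
  where
  open FirstKept (succR-firstKept R f (suc y))
  removed′ : ∀ γ → y ≤ γ → γ < succR R (suc y) f → γ ∈ R
  removed′ γ y≤γ γ<β with m≤n⇒m<n∨m≡n y≤γ
  ... | inj₁ y<γ = removed γ y<γ γ<β
  ... | inj₂ refl = elem-∈ R e
... | false = record
  { y≤β = ≤-refl ; β≤y+f = m≤m+n y (suc f)
  ; kept = inj₂ (λ m → contradiction (trans (sym (∈-elem R m)) e) λ ())
  ; removed = λ _ y≤γ γ<y → contradiction y≤γ (<⇒≱ γ<y) }

lastKept-≮ : ∀ {R y α α′} → LastKept R y α → LastKept R y α′ → ¬ α < α′
lastKept-≮ K K′ α<α′ with LastKept.kept K′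
... | inj₁ refl = n≮0 α<α′
... | inj₂ α′∉R = α′∉R (LastKept.removed K _ α<α′ (LastKept.α≤y K′))

lastKept-unique : ∀ {R y α α′} → LastKept R y α → LastKept R y α′ → α ≡ α′
lastKept-unique K K′ = ≤-antisym (≮⇒≥ (lastKept-≮ K′ K)) (≮⇒≥ (lastKept-≮ K K′))

firstKept-≮ : ∀ {R y f β β′} → FirstKept R y f β → FirstKept R y f β′ → ¬ β < β′
firstKept-≮ K K′ β<β′ with FirstKept.kept K
... | inj₁ refl = <⇒≱ β<β′ (FirstKept.β≤y+f K′)
... | inj₂ β∉R = β∉R (FirstKept.removed K′ _ (FirstKept.y≤β K) β<β′)

firstKept-unique : ∀ {R y f β β′} → FirstKept R y f β → FirstKept R y f β′ → β ≡ β′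
firstKept-unique K K′ = ≤-antisym (≮⇒≥ (firstKept-≮ K′ K)) (≮⇒≥ (firstKept-≮ K K′))

record GapAround (n : ℕ) (P : List ℕ) (a b : ℕ) : Set where
  field
    α β   : ℕ
    α<a   : α < a
    b<β   : b < β
    β≤1+n : β ≤ suc n
    α∉P   : α ∉ P
    β∉P   : β ∉ P
    below : ∀ {γ} → Between α a γ → γ ∈ P
    above : ∀ {γ} → Between b β γ → γ ∈ P

gap-around : ∀ {n} P {a b} → (∀ {γ} → γ ∈ P → 1 ≤ γ × γ ≤ n) → 1 ≤ a → b ≤ n → GapAround n P a b
gap-around {n} P {suc a} {b} range _ b≤n = record
  { α = predR P a ; β = succR P (suc b) (n ∸ b)
  ; α<a = s≤s L.α≤y ; b<β = F.y≤β ; β≤1+n = ≤-trans F.β≤y+f (≤-reflexive 1+n≡)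
  ; α∉P = α∉P ; β∉P = β∉P
  ; below = λ (α<γ , γ<1+a) → L.removed _ α<γ (≤-pred γ<1+a)
  ; above = λ (b<γ , γ<β) → F.removed _ b<γ γ<β }
  where
  module L = LastKept (predR-lastKept P a)
  module F = FirstKept (succR-firstKept P (n ∸ b) (suc b))
  1+n≡ : suc b + (n ∸ b) ≡ suc n
  1+n≡ = cong suc (m+[n∸m]≡n b≤n)
  α∉P : predR P a ∉ P
  α∉P α∈P with L.kept
  ... | inj₁ α≡0 = contradiction (subst (1 ≤_) α≡0 (proj₁ (range α∈P))) λ ()
  ... | inj₂ α∉P′ = α∉P′ α∈P
  β∉P : succR P (suc b) (n ∸ b) ∉ P
  β∉P β∈P with F.kept
  ... | inj₁ β≡ = contradiction (subst (_≤ n) (trans β≡ 1+n≡) (proj₂ (range β∈P))) (<-irrefl refl)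
  ... | inj₂ β∉P′ = β∉P′ β∈P

-- The diagonal phiAux emits when x is removed after the vertices of R.
dg : ℕ → List ℕ → ℕ → Pair
dg n R x = predR R (x ∸ 1) , succR R (suc x) (n ∸ x)

record Neighbours (n : ℕ) (R : List ℕ) (α x β : ℕ) : Set where
  field
    α<x     : α < x
    x<β     : x < β
    β≤1+n   : β ≤ suc n
    α∉R     : α ∉ R
    β∉R     : β ∉ R
    removed : ∀ γ → α < γ → γ < β → γ ≢ x → γ ∈ R

dg-eq : ∀ {n R α x β} → Neighbours n R α x β → dg n R x ≡ (α , β)
dg-eq {n} {R} {α} {suc x} {β} N =
  cong₂ _,_ (lastKept-unique (predR-lastKept R x) left)
            (firstKept-unique (succR-firstKept R (n ∸ suc x) (suc (suc x))) right)
  where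
  open Neighbours N
  left : LastKept R x α
  left = record
    { α≤y = ≤-pred α<x ; kept = inj₂ α∉R
    ; removed = λ γ α<γ γ≤x → removed γ α<γ (<-trans (s≤s γ≤x) x<β) (<⇒≢ (s≤s γ≤x)) }
  right : FirstKept R (suc (suc x)) (n ∸ suc x) β
  right = record
    { y≤β = x<β ; β≤y+f = ≤-trans β≤1+n (s≤s (m≤n+m∸n n (suc x))) ; kept = inj₂ β∉R
    ; removed = λ γ x<γ γ<β → removed γ (<-trans α<x x<γ) γ<β (>⇒≢ x<γ) }

dg-left : ∀ n R x {γ} → proj₁ (dg n R x) < γ → γ < x → γ ∈ R
dg-left n R (suc x) α<γ γ<x = LastKept.removed (predR-lastKept R x) _ α<γ (≤-pred γ<x)

dg-right : ∀ n R x {γ} → x < γ → γ < proj₂ (dg n R x) → γ ∈ R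
dg-right n R x = FirstKept.removed (succR-firstKept R (n ∸ x) (suc x)) _

dg-fst-kept : ∀ n R x → proj₁ (dg n R x) ∈ R → proj₁ (dg n R x) ≡ 0
dg-fst-kept n R x α∈R with LastKept.kept (predR-lastKept R (x ∸ 1))
... | inj₁ α≡0 = α≡0
... | inj₂ α∉R = contradiction α∈R α∉R

dg-snd-kept : ∀ n R x → proj₂ (dg n R x) ∈ R → suc n ≤ proj₂ (dg n R x)
dg-snd-kept n R x β∈R with FirstKept.kept (succR-firstKept R (n ∸ x) (suc x))
... | inj₁ β≡ = ≤-trans (s≤s (m≤n+m∸n n x)) (≤-reflexive (sym β≡))
... | inj₂ β∉R = contradiction β∈R β∉R

-- Unlike phiAux, this keeps the diagonal of the last vertex removed.
diagonals : ℕ → List ℕ → List ℕ → DiagSet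
diagonals n R []      = []
diagonals n R (x ∷ s) = dg n R x ∷ diagonals n (x ∷ R) s

diagonals-++ : ∀ n R A B → diagonals n R (A ++ B) ≡ diagonals n R A ++ diagonals n (A ʳ++ R) B
diagonals-++ n R []      B = refl
diagonals-++ n R (x ∷ A) B = cong (dg n R x ∷_) (diagonals-++ n (x ∷ R) A B)

phiAux-++ : ∀ n R A y t → phiAux n R (A ++ y ∷ t) ≡ diagonals n R A ++ phiAux n (A ʳ++ R) (y ∷ t)
phiAux-++ n R []          y t = refl
phiAux-++ n R (x ∷ [])    y t = refl
phiAux-++ n R (x ∷ x′ ∷ A) y t = cong (dg n R x ∷_) (phiAux-++ n (x ∷ R) (x′ ∷ A) y t)

phiAux-∷ʳ : ∀ n R A m → phiAux n R (A ++ m ∷ []) ≡ diagonals n R A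
phiAux-∷ʳ n R A m = trans (phiAux-++ n R A m []) (++-identityʳ (diagonals n R A))

phiAux⊆diagonals : ∀ n R s {e} → e ∈ phiAux n R s → e ∈ diagonals n R s
phiAux⊆diagonals n R (x ∷ y ∷ s) (here eq) = here eq
phiAux⊆diagonals n R (x ∷ y ∷ s) (there m) = there (phiAux⊆diagonals n (x ∷ R) (y ∷ s) m)

predR-cong : ∀ {R R′} → (∀ y → elem y R ≡ elem y R′) → ∀ y → predR R y ≡ predR R′ y
predR-cong E zero = refl
predR-cong E (suc y) = cong₂ (λ b α → if b then α else suc y) (E (suc y)) (predR-cong E y)

succR-cong : ∀ {R R′} → (∀ y → elem y R ≡ elem y R′) → ∀ f y → succR R y f ≡ succR R′ y f
succR-cong E zero    y = refl
succR-cong E (suc f) y = cong₂ (λ b β → if b then β else y) (E y) (succR-cong E f (suc y))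

phiAux-cong : ∀ n {R R′} → (∀ y → elem y R ≡ elem y R′) → ∀ t → phiAux n R t ≡ phiAux n R′ t
phiAux-cong n E []          = refl
phiAux-cong n E (x ∷ [])    = refl
phiAux-cong n E (x ∷ y ∷ t) =
  cong₂ _∷_ (cong₂ _,_ (predR-cong E (x ∸ 1)) (succR-cong E (n ∸ x) (suc x)))
            (phiAux-cong n (λ z → cong ((x ≡ᵇ z) ∨_) (E z)) (y ∷ t))

elem-swap : ∀ a b R y → elem y (a ∷ b ∷ R) ≡ elem y (b ∷ a ∷ R)
elem-swap a b R y = begin
  (a ≡ᵇ y) ∨ ((b ≡ᵇ y) ∨ elem y R)  ≡⟨ ∨-assoc (a ≡ᵇ y) _ _ ⟨
  ((a ≡ᵇ y) ∨ (b ≡ᵇ y)) ∨ elem y R  ≡⟨ cong (_∨ elem y R) (∨-comm (a ≡ᵇ y) _) ⟩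
  ((b ≡ᵇ y) ∨ (a ≡ᵇ y)) ∨ elem y R  ≡⟨ ∨-assoc (b ≡ᵇ y) _ _ ⟩
  (b ≡ᵇ y) ∨ ((a ≡ᵇ y) ∨ elem y R)  ∎
  where open ≡-Reasoning

diagonals-interior : ∀ n R s {e y} → e ∈ diagonals n R s → proj₁ e < y → y < proj₂ e → y ∈ R ⊎ y ∈ s
diagonals-interior n R (x ∷ s) {y = y} (here refl) α<y y<β with <-cmp y x
... | tri< y<x _ _ = inj₁ (dg-left n R x α<y y<x)
... | tri≈ _ y≡x _ = inj₂ (here y≡x)
... | tri> _ _ x<y = inj₁ (dg-right n R x x<y y<β)
diagonals-interior n R (x ∷ s) (there m) α<y y<β with diagonals-interior n (x ∷ R) s m α<y y<β
... | inj₁ (here y≡x) = inj₂ (here y≡x)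
... | inj₁ (there y∈R) = inj₁ y∈R
... | inj₂ y∈s = inj₂ (there y∈s)

diagonals-fst-kept : ∀ n R t {e} → e ∈ diagonals n R t → proj₁ e ∈ R → proj₁ e ≡ 0
diagonals-fst-kept n R (x ∷ t) (here refl) = dg-fst-kept n R x
diagonals-fst-kept n R (x ∷ t) (there m) α∈R = diagonals-fst-kept n (x ∷ R) t m (there α∈R)

diagonals-snd-kept : ∀ n R t {e} → e ∈ diagonals n R t → proj₂ e ∈ R → suc n ≤ proj₂ e
diagonals-snd-kept n R (x ∷ t) (here refl) = dg-snd-kept n R x
diagonals-snd-kept n R (x ∷ t) (there m) β∈R = diagonals-snd-kept n (x ∷ R) t m (there β∈R)

diagonals-gap : ∀ n R s {α β} → β ≤ suc n → α ∉ R → α ∉ s → β ∉ R → β ∉ s →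
                (∀ γ → Between α β γ → γ ∈ R ⊎ γ ∈ s) → Any (Between α β) s →
                (α , β) ∈ diagonals n R s
diagonals-gap n R (x ∷ s) {α} {β} β≤ α∉R α∉s β∉R β∉s filled inside
  with any? (λ γ → (α <? γ) ×-dec (γ <? β)) s
... | yes inside′ =
  there (diagonals-gap n (x ∷ R) s β≤ (∉-∷ α∉s α∉R) (α∉s ∘ there) (∉-∷ β∉s β∉R) (β∉s ∘ there) filled′ inside′)
  where
  ∉-∷ : ∀ {y} → y ∉ x ∷ s → y ∉ R → y ∉ x ∷ R
  ∉-∷ y∉s y∉R (here y≡x) = y∉s (here y≡x)
  ∉-∷ y∉s y∉R (there y∈R) = y∉R y∈R
  filled′ : ∀ γ → Between α β γ → γ ∈ x ∷ R ⊎ γ ∈ s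
  filled′ γ b with filled γ b
  ... | inj₁ γ∈R = inj₁ (there γ∈R)
  ... | inj₂ (here γ≡x) = inj₁ (here γ≡x)
  ... | inj₂ (there γ∈s) = inj₂ γ∈s
... | no outside = here (sym (dg-eq record
  { α<x = proj₁ x-between ; x<β = proj₂ x-between ; β≤1+n = β≤ ; α∉R = α∉R ; β∉R = β∉R
  ; removed = removed }))
  where
  x-between : Between α β x
  x-between = head-between inside
    where
    head-between : Any (Between α β) (x ∷ s) → Between α β x
    head-between (here b)  = b
    head-between (there b) = contradiction b outside
  removed : ∀ γ → α < γ → γ < β → γ ≢ x → γ ∈ R
  removed γ α<γ γ<β γ≢x with filled γ (α<γ , γ<β)
  ... | inj₁ γ∈R = γ∈R
  ... | inj₂ (here γ≡x) = contradiction γ≡x γ≢x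
  ... | inj₂ (there γ∈s) = contradiction (Any.map (λ { refl → α<γ , γ<β }) γ∈s) outside

edge-of-gap : ∀ n s {α β} → α < β → β ≤ suc n → α ∉ s → β ∉ s →
              (∀ γ → Between α β γ → γ ∈ s) → Edge n (diagonals n [] s) α β
edge-of-gap n s {α} {β} α<β β≤ α∉s β∉s filled with β ≟ suc α
... | yes β≡1+α = inj₁ β≡1+α
... | no β≢1+α = inj₂ (inj₂ (diagonals-gap n [] s β≤ (λ ()) α∉s (λ ()) β∉s (λ γ → inj₂ ∘ filled γ)
                   (Any.map (λ { refl → 1+α-between }) (filled _ 1+α-between))))
  where
  1+α-between : Between α β (suc α)
  1+α-between = ≤-refl , ≤∧≢⇒< α<β (β≢1+α ∘ sym)

-- Transposing two adjacent vertices of a reading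

Edge-mono : ∀ {n D D′ α β} → (∀ {e} → e ∈ D → e ∈ D′) → Edge n D α β → Edge n D′ α β
Edge-mono D⊆D′ (inj₁ side)          = inj₁ side
Edge-mono D⊆D′ (inj₂ (inj₁ outer))  = inj₂ (inj₁ outer)
Edge-mono D⊆D′ (inj₂ (inj₂ e∈D))    = inj₂ (inj₂ (D⊆D′ e∈D))

record Transposition (n : ℕ) (s : List ℕ) (a b : ℕ) (t : List ℕ) (α β : ℕ) : Set where
  field
    X Y     : DiagSet
    before  : φ n (s ++ a ∷ b ∷ t) ≡ X ++ (α , b) ∷ Y
    after   : φ n (s ++ b ∷ a ∷ t) ≡ X ++ (a , β) ∷ Y
    avoids  : ∀ {e} → e ∈ X ++ Y → e ≢ (α , b) × e ≢ (a , β)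
    edge-αa : Edge n (X ++ Y) α a
    edge-ab : Edge n (X ++ Y) a b
    edge-bβ : Edge n (X ++ Y) b β
    edge-αβ : Edge n (X ++ Y) α β

transposition : ∀ n s t {α a b β} → α < a → a < b → b < β → β ≤ suc n →
                α ∉ s → a ∉ s → b ∉ s → β ∉ s →
                (∀ γ → Between α β γ → γ ≢ a → γ ≢ b → γ ∈ s) →
                (∀ {γ} → 1 ≤ γ × γ ≤ n → γ ∈ s ++ a ∷ b ∷ t) →
                Transposition n s a b t α β
transposition n s t {α} {a} {b} {β} α<a a<b b<β β≤ α∉s a∉s b∉s β∉s filled covered = record
  { X = X ; Y = Y ; before = before ; after = after ; avoids = avoids
  ; edge-αa = Edge-mono ∈-++⁺ˡ (edge-of-gap n s α<a a≤1+n α∉s a∉s λ γ (α<γ , γ<a) →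
                filled γ (α<γ , <-trans γ<a (<-trans a<b b<β)) (<⇒≢ γ<a) (<⇒≢ (<-trans γ<a a<b)))
  ; edge-ab = Edge-mono ∈-++⁺ˡ (edge-of-gap n s a<b b≤1+n a∉s b∉s λ γ (a<γ , γ<b) →
                filled γ (<-trans α<a a<γ , <-trans γ<b b<β) (>⇒≢ a<γ) (<⇒≢ γ<b))
  ; edge-bβ = Edge-mono ∈-++⁺ˡ (edge-of-gap n s b<β β≤ b∉s β∉s λ γ (b<γ , γ<β) →
                filled γ (<-trans (<-trans α<a a<b) b<γ , γ<β) (>⇒≢ (<-trans a<b b<γ)) (>⇒≢ b<γ))
  ; edge-αβ = edge-αβ t refl }
  where
  R : List ℕ
  R = s ʳ++ []

  ∉R : ∀ {y} → y ∉ s → y ∉ R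
  ∉R y∉s y∈R with ∈-ʳ++⁻ s [] y∈R
  ... | inj₁ y∈s = y∉s y∈s

  ∈R : ∀ {y} → y ∈ s → y ∈ R
  ∈R y∈s = ∈-ʳ++⁺ s [] (inj₁ y∈s)

  ∉∷R : ∀ {x y} → y ≢ x → y ∉ s → y ∉ x ∷ R
  ∉∷R y≢x y∉s (here y≡x)  = y≢x y≡x
  ∉∷R y≢x y∉s (there y∈R) = ∉R y∉s y∈R

  b≤n : b ≤ n
  b≤n = ≤-pred (≤-trans b<β β≤)
  a≤1+n : a ≤ suc n
  a≤1+n = ≤-trans (<⇒≤ a<b) (m≤n⇒m≤1+n b≤n)
  b≤1+n : b ≤ suc n
  b≤1+n = m≤n⇒m≤1+n b≤n

  dg-a : dg n R a ≡ (α , b)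
  dg-a = dg-eq record
    { α<x = α<a ; x<β = a<b ; β≤1+n = b≤1+n ; α∉R = ∉R α∉s ; β∉R = ∉R b∉s
    ; removed = λ γ α<γ γ<b γ≢a → ∈R (filled γ (α<γ , <-trans γ<b b<β) γ≢a (<⇒≢ γ<b)) }

  dg-b : dg n R b ≡ (a , β)
  dg-b = dg-eq record
    { α<x = a<b ; x<β = b<β ; β≤1+n = β≤ ; α∉R = ∉R a∉s ; β∉R = ∉R β∉s
    ; removed = λ γ a<γ γ<β γ≢b → ∈R (filled γ (<-trans α<a a<γ , γ<β) (>⇒≢ a<γ) γ≢b) }

  dg-b-after-a : dg n (a ∷ R) b ≡ (α , β)
  dg-b-after-a = dg-eq record
    { α<x = <-trans α<a a<b ; x<β = b<β ; β≤1+n = β≤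
    ; α∉R = ∉∷R (<⇒≢ α<a) α∉s ; β∉R = ∉∷R (>⇒≢ (<-trans a<b b<β)) β∉s
    ; removed = removed }
    where
    removed : ∀ γ → α < γ → γ < β → γ ≢ b → γ ∈ a ∷ R
    removed γ α<γ γ<β γ≢b with γ ≟ a
    ... | yes γ≡a = here γ≡a
    ... | no γ≢a  = there (∈R (filled γ (α<γ , γ<β) γ≢a γ≢b))

  dg-a-after-b : dg n (b ∷ R) a ≡ (α , β)
  dg-a-after-b = dg-eq record
    { α<x = α<a ; x<β = <-trans a<b b<β ; β≤1+n = β≤
    ; α∉R = ∉∷R (<⇒≢ (<-trans α<a a<b)) α∉s ; β∉R = ∉∷R (>⇒≢ b<β) β∉s
    ; removed = removed }
    where
    removed : ∀ γ → α < γ → γ < β → γ ≢ a → γ ∈ b ∷ R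
    removed γ α<γ γ<β γ≢a with γ ≟ b
    ... | yes γ≡b = here γ≡b
    ... | no γ≢b  = there (∈R (filled γ (α<γ , γ<β) γ≢a γ≢b))

  X Y : DiagSet
  X = diagonals n [] s
  Y = phiAux n (a ∷ R) (b ∷ t)

  before : φ n (s ++ a ∷ b ∷ t) ≡ X ++ (α , b) ∷ Y
  before = trans (phiAux-++ n [] s a (b ∷ t)) (cong (λ d → X ++ d ∷ Y) dg-a)

  -- Once both a and b are removed the removed sets agree, so the later diagonals coincide.
  tail-swap : ∀ t′ → phiAux n (b ∷ R) (a ∷ t′) ≡ phiAux n (a ∷ R) (b ∷ t′)
  tail-swap []       = refl
  tail-swap (y ∷ t′) = cong₂ _∷_ (trans dg-a-after-b (sym dg-b-after-a))
                                 (phiAux-cong n (elem-swap a b R) (y ∷ t′))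

  after : φ n (s ++ b ∷ a ∷ t) ≡ X ++ (a , β) ∷ Y
  after = trans (phiAux-++ n [] s b (a ∷ t)) (cong₂ (λ d Z → X ++ d ∷ Z) dg-b (tail-swap t))

  avoids : ∀ {e} → e ∈ X ++ Y → e ≢ (α , b) × e ≢ (a , β)
  avoids e∈ with ∈-++⁻ X e∈
  ... | inj₁ e∈X =
    (λ { refl → [ (λ ()) , a∉s ]′ (diagonals-interior n [] s e∈X α<a a<b) }) ,
    (λ { refl → [ (λ ()) , b∉s ]′ (diagonals-interior n [] s e∈X a<b b<β) })
  ... | inj₂ e∈Y with phiAux⊆diagonals n (a ∷ R) (b ∷ t) e∈Y
  ...   | here refl rewrite dg-b-after-a =
    (λ eq → <⇒≢ b<β (sym (cong proj₂ eq))) , (λ eq → <⇒≢ α<a (cong proj₁ eq))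
  ...   | there e∈t =
    (λ { refl → <⇒≱ (s≤s b≤n) (diagonals-snd-kept n (b ∷ a ∷ R) t e∈t (here refl)) }) ,
    (λ { refl → <⇒≢ (≤-<-trans z≤n α<a) (sym (diagonals-fst-kept n (b ∷ a ∷ R) t e∈t (there (here refl)))) })

  edge-αβ : ∀ t′ → t ≡ t′ → Edge n (X ++ Y) α β
  edge-αβ (_ ∷ _) refl = inj₂ (inj₂ (∈-++⁺ʳ X (here (sym dg-b-after-a))))
  edge-αβ []      refl = inj₂ (inj₁ (α≡0 , β≡1+n))
    where
    outside : ∀ {y} → y ∉ s → y ≢ a → y ≢ b → 1 ≤ y → y ≤ n → ⊥
    outside y∉s y≢a y≢b 1≤y y≤n with ∈-++⁻ s (covered (1≤y , y≤n))
    ... | inj₁ y∈s = y∉s y∈s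
    ... | inj₂ (here y≡a) = y≢a y≡a
    ... | inj₂ (there (here y≡b)) = y≢b y≡b
    α≡0 : α ≡ 0
    α≡0 with α ≟ 0
    ... | yes α≡0 = α≡0
    ... | no α≢0 = ⊥-elim (outside α∉s (<⇒≢ α<a) (<⇒≢ (<-trans α<a a<b)) (n≢0⇒n>0 α≢0)
                     (≤-trans (<⇒≤ (<-trans α<a a<b)) b≤n))
    β≡1+n : β ≡ suc n
    β≡1+n with β ≟ suc n
    ... | yes β≡ = β≡
    ... | no β≢ = ⊥-elim (outside β∉s (>⇒≢ (<-trans a<b b<β)) (>⇒≢ b<β) (≤-trans (s≤s z≤n) b<β)
                    (≤-pred (≤∧≢⇒< β≤ β≢)))

∈-insert⁻ : ∀ {A : Set} {e d : A} X Y → e ∈ X ++ d ∷ Y → e ≡ d ⊎ e ∈ X ++ Y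
∈-insert⁻ X Y e∈ with ∈-++⁻ X e∈
... | inj₁ e∈X       = inj₂ (∈-++⁺ˡ e∈X)
... | inj₂ (here e≡d) = inj₁ e≡d
... | inj₂ (there e∈Y) = inj₂ (∈-++⁺ʳ X e∈Y)

∈-insert⁺ : ∀ {A : Set} {e d : A} X Y → e ∈ X ++ Y → e ∈ X ++ d ∷ Y
∈-insert⁺ X Y e∈ with ∈-++⁻ X e∈
... | inj₁ e∈X = ∈-++⁺ˡ e∈X
... | inj₂ e∈Y = ∈-++⁺ʳ X (there e∈Y)

module _ {X Y : DiagSet} {d d′ : Pair} {T T′ : DiagSet}
         (avoids : ∀ {e} → e ∈ X ++ Y → e ≢ d × e ≢ d′) where

  replace-of-≈ˢ : (X ++ d ∷ Y) ≈ˢ T → (X ++ d′ ∷ Y) ≈ˢ T′ → Replace T d d′ T′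
  replace-of-≈ˢ D≈T D′≈T′ e = forth , back
    where
    forth : e ∈ T′ → e ≡ d′ ⊎ (e ∈ T × e ≢ d)
    forth e∈T′ with ∈-insert⁻ X Y (proj₂ (D′≈T′ e) e∈T′)
    ... | inj₁ e≡d′ = inj₁ e≡d′
    ... | inj₂ e∈XY = inj₂ (proj₁ (D≈T e) (∈-insert⁺ X Y e∈XY) , proj₁ (avoids e∈XY))
    back : e ≡ d′ ⊎ (e ∈ T × e ≢ d) → e ∈ T′
    back (inj₁ refl) = proj₁ (D′≈T′ e) (∈-++⁺ʳ X (here refl))
    back (inj₂ (e∈T , e≢d)) with ∈-insert⁻ X Y (proj₂ (D≈T e) e∈T)
    ... | inj₁ e≡d  = contradiction e≡d e≢d
    ... | inj₂ e∈XY = proj₁ (D′≈T′ e) (∈-insert⁺ X Y e∈XY)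

  ≈ˢ-of-replace : (X ++ d ∷ Y) ≈ˢ T → Replace T d d′ T′ → (X ++ d′ ∷ Y) ≈ˢ T′
  ≈ˢ-of-replace D≈T replace e = forth , back
    where
    forth : e ∈ X ++ d′ ∷ Y → e ∈ T′
    forth e∈ with ∈-insert⁻ X Y e∈
    ... | inj₁ e≡d′ = proj₂ (replace e) (inj₁ e≡d′)
    ... | inj₂ e∈XY = proj₂ (replace e) (inj₂ (proj₁ (D≈T e) (∈-insert⁺ X Y e∈XY) , proj₁ (avoids e∈XY)))
    back : e ∈ T′ → e ∈ X ++ d′ ∷ Y
    back e∈T′ with proj₁ (replace e) e∈T′
    ... | inj₁ refl = ∈-++⁺ʳ X (here refl)
    ... | inj₂ (e∈T , e≢d) with ∈-insert⁻ X Y (proj₂ (D≈T e) e∈T)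
    ...   | inj₁ e≡d  = contradiction e≡d e≢d
    ...   | inj₂ e∈XY = ∈-insert⁺ X Y e∈XY

transposition-flips : ∀ {p} (μ : Vec ℕ p) {s a b t α β T T′} → Transposition (size μ) s a b t α β →
                      α < a → a < b → b < β → col μ a ≢ col μ b →
                      φ (size μ) (s ++ a ∷ b ∷ t) ≈ˢ T → φ (size μ) (s ++ b ∷ a ∷ t) ≈ˢ T′ →
                      SwitchedFlip μ T T′ × SwitchedFlip μ T′ T
transposition-flips μ {a = a} {b} {α = α} {β} {T} {T′} o α<a a<b b<β a≁b σ≈T σ′≈T′ =
  (α , a , b , β , α<a , a<b , b<β , a≁b ,
   inj₁ (αb∈T , (α<a , a<b , in-T edge-αa , in-T edge-ab , inj₂ (inj₂ αb∈T)) ,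
         (<-trans α<a a<b , b<β , inj₂ (inj₂ αb∈T) , in-T edge-bβ , in-T edge-αβ) ,
         replace-of-≈ˢ avoids D≈T D′≈T′)) ,
  (α , a , b , β , α<a , a<b , b<β , a≁b ,
   inj₂ (aβ∈T′ , (α<a , <-trans a<b b<β , in-T′ edge-αa , inj₂ (inj₂ aβ∈T′) , in-T′ edge-αβ) ,
         (a<b , b<β , in-T′ edge-ab , in-T′ edge-bβ , inj₂ (inj₂ aβ∈T′)) ,
         replace-of-≈ˢ (Product.swap ∘ avoids) D′≈T′ D≈T))
  where
  open Transposition o
  D≈T : (X ++ (α , b) ∷ Y) ≈ˢ T
  D≈T = subst (_≈ˢ T) before σ≈T
  D′≈T′ : (X ++ (a , β) ∷ Y) ≈ˢ T′
  D′≈T′ = subst (_≈ˢ T′) after σ′≈T′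
  in-T : ∀ {x y} → Edge (size μ) (X ++ Y) x y → Edge (size μ) T x y
  in-T = Edge-mono λ e∈ → proj₁ (D≈T _) (∈-insert⁺ X Y e∈)
  in-T′ : ∀ {x y} → Edge (size μ) (X ++ Y) x y → Edge (size μ) T′ x y
  in-T′ = Edge-mono λ e∈ → proj₁ (D′≈T′ _) (∈-insert⁺ X Y e∈)
  αb∈T : (α , b) ∈ T
  αb∈T = proj₁ (D≈T _) (∈-++⁺ʳ X (here refl))
  aβ∈T′ : (a , β) ∈ T′
  aβ∈T′ = proj₁ (D′≈T′ _) (∈-++⁺ʳ X (here refl))

-- Colours and standardisation

nth-replicate : ∀ {A : Set} (c : A) m r j → j < m → nth (replicateL m c ++ r) j ≡ just c
nth-replicate c (suc m) r zero    _   = refl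
nth-replicate c (suc m) r (suc j) j<m = nth-replicate c m r j (≤-pred j<m)

nth-skip-replicate : ∀ {A : Set} (c : A) m r i → nth (replicateL m c ++ r) (m + i) ≡ nth r i
nth-skip-replicate c zero    r i = refl
nth-skip-replicate c (suc m) r i = nth-skip-replicate c m r i

nth-εAux : ∀ {p q} (f : Fin q → Fin p) (μ : Vec ℕ q) k {j} → j < lookup μ k →
           nth (εAux f μ) (offset μ k + j) ≡ just (f k)
nth-εAux f (m ∷ᵛ μ) zero    j< = nth-replicate (f zero) m _ _ j<
nth-εAux f (m ∷ᵛ μ) (suc k) {j} j< = begin
  nth (εAux f (m ∷ᵛ μ)) (m + offset μ k + j)    ≡⟨ cong (nth (εAux f (m ∷ᵛ μ))) (+-assoc m (offset μ k) j) ⟩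
  nth (εAux f (m ∷ᵛ μ)) (m + (offset μ k + j))  ≡⟨ nth-skip-replicate (f zero) m _ _ ⟩
  nth (εAux (f ∘ suc) μ) (offset μ k + j)       ≡⟨ nth-εAux (f ∘ suc) μ k j< ⟩
  just (f (suc k))                              ∎
  where open ≡-Reasoning

offset-decompose : ∀ {q} (μ : Vec ℕ q) i → i < size μ → ∃₂ λ k j → j < lookup μ k × i ≡ offset μ k + j
offset-decompose (m ∷ᵛ μ) i i< with i <? m
... | yes i<m = zero , i , i<m , refl
... | no i≮m with offset-decompose μ (i ∸ m) (+-cancelˡ-< m _ _ (subst (_< m + size μ) (sym (m+[n∸m]≡n (≮⇒≥ i≮m))) i<))
...   | k , j , j< , i∸m≡ = suc k , j , j< , (begin
  i                     ≡⟨ m+[n∸m]≡n (≮⇒≥ i≮m) ⟨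
  m + (i ∸ m)           ≡⟨ cong (m +_) i∸m≡ ⟩
  m + (offset μ k + j)  ≡⟨ +-assoc m _ j ⟨
  m + offset μ k + j    ∎)
  where open ≡-Reasoning

offset-mono : ∀ {q} (μ : Vec ℕ q) {k k′} → k <ᶠ k′ → offset μ k + lookup μ k ≤ offset μ k′
offset-mono (m ∷ᵛ μ) {zero}  {suc k′} _ = m≤m+n m _
offset-mono (m ∷ᵛ μ) {suc k} {suc k′} (s≤s k<k′) =
  ≤-trans (≤-reflexive (+-assoc m (offset μ k) _)) (+-monoʳ-≤ m (offset-mono μ k<k′))

offset-bound : ∀ {q} (μ : Vec ℕ q) k → offset μ k + lookup μ k ≤ size μ
offset-bound (m ∷ᵛ μ) zero    = m≤m+n m _
offset-bound (m ∷ᵛ μ) (suc k) =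
  ≤-trans (≤-reflexive (+-assoc m (offset μ k) _)) (+-monoʳ-≤ m (offset-bound μ k))

count-here : ∀ {p} (c : Fin p) S → count c (c ∷ S) ≡ suc (count c S)
count-here c S with c ≟ᶠ c
... | yes _   = refl
... | no c≢c = contradiction refl c≢c

count-there : ∀ {p} {c d : Fin p} S → c ≢ d → count c (d ∷ S) ≡ count c S
count-there {c = c} {d} S c≢d with c ≟ᶠ d
... | yes c≡d = contradiction c≡d c≢d
... | no _    = refl

count-≤-∷ : ∀ {p} (c d : Fin p) S → count c S ≤ count c (d ∷ S)
count-≤-∷ c d S with c ≟ᶠ d
... | yes _ = n≤1+n _
... | no _  = ≤-refl

count-++ : ∀ {p} (c : Fin p) A B → count c (A ++ B) ≡ count c A + count c B
count-++ c []      B = refl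
count-++ c (d ∷ A) B with c ≟ᶠ d
... | yes _ = cong suc (count-++ c A B)
... | no _  = count-++ c A B

count-ʳ++ : ∀ {p} (c : Fin p) A B → count c (A ʳ++ B) ≡ count c A + count c B
count-ʳ++ c []      B = refl
count-ʳ++ c (d ∷ A) B with c ≟ᶠ d
... | yes refl = trans (count-ʳ++ c A (c ∷ B)) (trans (cong (count c A +_) (count-here c B)) (+-suc _ _))
... | no c≢d   = trans (count-ʳ++ c A (d ∷ B)) (cong (count c A +_) (count-there B c≢d))

count-pos : ∀ {p} {c : Fin p} {r} → c ∈ r → 0 < count c r
count-pos {c = c} {_ ∷ r} (here refl)  = subst (0 <_) (sym (count-here c r)) (s≤s z≤n)
count-pos {c = c} {d ∷ r} (there c∈r) = ≤-trans (count-pos c∈r) (count-≤-∷ c d r)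

count-swap : ∀ {p} (c x z : Fin p) S → count c (x ∷ z ∷ S) ≡ count c (z ∷ x ∷ S)
count-swap c x z S with c ≟ᶠ x | c ≟ᶠ z
... | yes _ | yes _ = refl
... | yes _ | no _  = refl
... | no _  | yes _ = refl
... | no _  | no _  = refl

count-transpose : ∀ {p} (c : Fin p) u x z v → count c (u ++ x ∷ z ∷ v) ≡ count c (u ++ z ∷ x ∷ v)
count-transpose c u x z v = begin
  count c (u ++ x ∷ z ∷ v)           ≡⟨ count-++ c u _ ⟩
  count c u + count c (x ∷ z ∷ v)   ≡⟨ cong (count c u +_) (count-swap c x z v) ⟩
  count c u + count c (z ∷ x ∷ v)   ≡⟨ count-++ c u _ ⟨
  count c (u ++ z ∷ x ∷ v)           ∎
  where open ≡-Reasoning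

data Precedes {A : Set} (x y : A) : List A → Set where
  now   : ∀ {L} → y ∈ L → Precedes x y (x ∷ L)
  later : ∀ {z L} → Precedes x y L → Precedes x y (z ∷ L)

module _ {A : Set} where

  Precedes-snd : ∀ {x y : A} {L} → Precedes x y L → y ∈ L
  Precedes-snd (now y∈L) = there y∈L
  Precedes-snd (later p) = there (Precedes-snd p)

  Precedes-trans : ∀ {a b c : A} {L} → Unique L → Precedes a b L → Precedes b c L → Precedes a c L
  Precedes-trans (a∉ ∷ _)  (now a∈L) (now _)   = contradiction refl (All.lookup a∉ a∈L)
  Precedes-trans _         (now _)   (later q) = now (Precedes-snd q)
  Precedes-trans (b∉ ∷ _)  (later p) (now _)   = contradiction refl (All.lookup b∉ (Precedes-snd p))
  Precedes-trans (_ ∷ uL)  (later p) (later q) = later (Precedes-trans uL p q)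

  Precedes-++ˡ : ∀ {x y : A} L M → Precedes x y L → Precedes x y (L ++ M)
  Precedes-++ˡ (_ ∷ L) M (now y∈L) = now (∈-++⁺ˡ y∈L)
  Precedes-++ˡ (_ ∷ L) M (later p) = later (Precedes-++ˡ L M p)

  Precedes-++ʳ : ∀ {x y : A} L {M} → Precedes x y M → Precedes x y (L ++ M)
  Precedes-++ʳ []      p = p
  Precedes-++ʳ (_ ∷ L) p = later (Precedes-++ʳ L p)

  Precedes-++ : ∀ {x y : A} L M → x ∈ L → y ∈ M → Precedes x y (L ++ M)
  Precedes-++ (_ ∷ L) M (here refl) y∈M = now (∈-++⁺ʳ L y∈M)
  Precedes-++ (_ ∷ L) M (there x∈L) y∈M = later (Precedes-++ L M x∈L y∈M)

  Unique-++⇒disjoint : ∀ L {M} {y : A} → Unique (L ++ M) → y ∈ L → y ∉ M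
  Unique-++⇒disjoint (x ∷ L) (x∉ ∷ _) (here refl) y∈M = All.lookup x∉ (∈-++⁺ʳ L y∈M) refl
  Unique-++⇒disjoint (x ∷ L) (_ ∷ u)  (there y∈L) = Unique-++⇒disjoint L u y∈L

  Precedes-before : ∀ L {x y : A} {M} → Unique (L ++ x ∷ M) → Precedes y x (L ++ x ∷ M) → y ∈ L
  Precedes-before []      (x∉M ∷ _) (now x∈M) = contradiction x∈M (All¬⇒¬Any x∉M)
  Precedes-before []      (x∉M ∷ _) (later p) = contradiction (Precedes-snd p) (All¬⇒¬Any x∉M)
  Precedes-before (z ∷ L) _         (now _)   = here refl
  Precedes-before (z ∷ L) (_ ∷ u)   (later p) = there (Precedes-before L u p)

  transpose-at : ∀ (P : List A) {P′ Q Q′ a b a′ b′} → length P ≡ length P′ →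
                 P ++ a ∷ b ∷ Q ≡ P′ ++ a′ ∷ b′ ∷ Q′ → P ++ b ∷ a ∷ Q ≡ P′ ++ b′ ∷ a′ ∷ Q′
  transpose-at []      {[]}     _   refl = refl
  transpose-at (x ∷ P) {x′ ∷ P′} len eq =
    cong₂ _∷_ (∷-injectiveˡ eq) (transpose-at P (suc-injective len) (∷-injectiveʳ eq))

record IsPermutation (n : ℕ) (σ : List ℕ) : Set where
  field
    unique : Unique σ
    range  : ∀ {γ} → γ ∈ σ → 1 ≤ γ × γ ≤ n
    cover  : ∀ {γ} → 1 ≤ γ × γ ≤ n → γ ∈ σ

module Colours {p} (μ : Vec ℕ p) where

  n : ℕ
  n = size μ

  off : Fin p → ℕ
  off = offset μ

  InBlock : Fin p → ℕ → Set
  InBlock k y = off k < y × y ≤ off k + lookup μ k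

  inBlock-col : ∀ {k y} → InBlock k y → col μ y ≡ just k
  inBlock-col {k} {suc y} (off<1+y , 1+y≤) = begin
    nth (εμ μ) y                     ≡⟨ cong (nth (εμ μ)) y≡ ⟨
    nth (εμ μ) (off k + (y ∸ off k)) ≡⟨ nth-εAux (λ i → i) μ k j< ⟩
    just k                           ∎
    where
    open ≡-Reasoning
    y≡ : off k + (y ∸ off k) ≡ y
    y≡ = m+[n∸m]≡n (≤-pred off<1+y)
    j< : y ∸ off k < lookup μ k
    j< = +-cancelˡ-< (off k) _ _ (subst (_< off k + lookup μ k) (sym y≡) 1+y≤)

  block-of : ∀ {y} → 1 ≤ y × y ≤ n → ∃ λ k → InBlock k y
  block-of {suc y} (_ , 1+y≤n) with offset-decompose μ y 1+y≤n
  ... | k , j , j< , refl = k , s≤s (m≤m+n _ j) , ≤-trans (≤-reflexive (sym (+-suc _ j))) (+-monoʳ-≤ (off k) j<)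

  inBlock-unique : ∀ {k k′ y} → InBlock k y → InBlock k′ y → k ≡ k′
  inBlock-unique b b′ = just-injective (trans (sym (inBlock-col b)) (inBlock-col b′))

  inBlock-range : ∀ {k y} → InBlock k y → 1 ≤ y × y ≤ n
  inBlock-range {k} (off<y , y≤) = ≤-trans (s≤s z≤n) off<y , ≤-trans y≤ (offset-bound μ k)

  inBlock-≤ : ∀ {k k′ y y′} → InBlock k y → InBlock k′ y′ → y ≤ y′ → k ≤ᶠ k′
  inBlock-≤ {k} {k′} b b′ y≤y′ with FP.<-cmp k k′
  ... | tri< k<k′ _ _ = <⇒≤ k<k′
  ... | tri≈ _ refl _ = ≤-refl
  ... | tri> _ _ k′<k = contradiction (≤-trans y≤y′ (≤-trans (proj₂ b′) (offset-mono μ k′<k))) (<⇒≱ (proj₁ b))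

  inBlock-< : ∀ {k k′ y y′} → InBlock k y → InBlock k′ y′ → k <ᶠ k′ → y < y′
  inBlock-< b b′ k<k′ = ≤-<-trans (≤-trans (proj₂ b) (offset-mono μ k<k′)) (proj₁ b′)

  label : List (Fin p) → Fin p → ℕ
  label S c = off c + suc (count c S)

  inBlock-+ : ∀ {c j} → j < lookup μ c → InBlock c (off c + suc j)
  inBlock-+ {c} j< = m<m+n (off c) (s≤s z≤n) , +-monoʳ-≤ (off c) j<

  stdAux-++ : ∀ S u r → stdAux μ S (u ++ r) ≡ stdAux μ S u ++ stdAux μ (u ʳ++ S) r
  stdAux-++ S []      r = refl
  stdAux-++ S (c ∷ u) r = cong (label S c ∷_) (stdAux-++ (c ∷ S) u r)

  length-stdAux : ∀ S u → length (stdAux μ S u) ≡ length u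
  length-stdAux S []      = refl
  length-stdAux S (c ∷ u) = cong suc (length-stdAux (c ∷ S) u)

  stdAux-cong : ∀ {S S′} → (∀ c → count c S ≡ count c S′) → ∀ w → stdAux μ S w ≡ stdAux μ S′ w
  stdAux-cong E []      = refl
  stdAux-cong {S} {S′} E (c ∷ w) =
    cong₂ _∷_ (cong (λ k → off c + suc k) (E c)) (stdAux-cong E′ w)
    where
    E′ : ∀ d → count d (c ∷ S) ≡ count d (c ∷ S′)
    E′ d with d ≟ᶠ c
    ... | yes _ = cong suc (E d)
    ... | no _  = E d

  -- v ʳ++ S is the list of letters seen once v has been read.
  stdAux-∈ : ∀ S v {e} → e ∈ stdAux μ S v →
             ∃₂ λ c j → c ∈ v × count c S ≤ j × j < count c (v ʳ++ S) × e ≡ off c + suc j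
  stdAux-∈ S (c ∷ v) (here refl) = c , count c S , here refl , ≤-refl , count< , refl
    where
    count< : count c S < count c (v ʳ++ c ∷ S)
    count< = ≤-trans (≤-reflexive (sym (count-here c S)))
               (≤-trans (m≤n+m _ (count c v)) (≤-reflexive (sym (count-ʳ++ c v (c ∷ S)))))
  stdAux-∈ S (c ∷ v) (there e∈) with stdAux-∈ (c ∷ S) v e∈
  ... | c′ , j , c′∈v , ≤j , j< , e≡ = c′ , j , there c′∈v , ≤-trans (count-≤-∷ c′ c S) ≤j , j< , e≡

  stdAux-∋ : ∀ S v c {j} → j < count c v → off c + suc (j + count c S) ∈ stdAux μ S v
  stdAux-∋ S (d ∷ v) c {j} j< with c ≟ᶠ d
  stdAux-∋ S (d ∷ v) c {zero}  j< | yes refl = here refl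
  stdAux-∋ S (d ∷ v) c {suc j} j< | yes refl =
    there (subst (λ k → off c + suc k ∈ stdAux μ (c ∷ S) v)
                 (trans (cong (j +_) (count-here c S)) (+-suc j _))
                 (stdAux-∋ (c ∷ S) v c (≤-pred j<)))
  ... | no c≢d =
    there (subst (λ k → off c + suc (j + k) ∈ stdAux μ (d ∷ S) v) (count-there S c≢d)
                 (stdAux-∋ (d ∷ S) v c j<))

  stdAux-unique : ∀ S v → (∀ c → count c (v ʳ++ S) ≤ lookup μ c) → Unique (stdAux μ S v)
  stdAux-unique S []      bounded = []
  stdAux-unique S (c ∷ v) bounded = ¬Any⇒All¬ _ head∉ ∷ stdAux-unique (c ∷ S) v bounded
    where
    head∉ : label S c ∉ stdAux μ (c ∷ S) v
    head∉ e∈ with stdAux-∈ (c ∷ S) v e∈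
    ... | c′ , j , _ , ≤j , j< , e≡ with c′ ≟ᶠ c
    ...   | yes refl = <⇒≢ (+-monoʳ-< (off c) (s≤s ≤j)) e≡
    ...   | no c′≢c = c′≢c (inBlock-unique (subst (InBlock c′) (sym e≡) (inBlock-+ (≤-trans j< (bounded c′))))
                                          (inBlock-+ c<))
      where
      c< : count c S < lookup μ c
      c< = ≤-trans (≤-trans (≤-reflexive (sym (count-here c S))) (m≤n+m _ (count c v)))
                   (≤-trans (≤-reflexive (sym (count-ʳ++ c v (c ∷ S)))) (bounded c))

  inBlock-decompose : ∀ {k y} → InBlock k y → ∃ λ j → j < lookup μ k × y ≡ off k + suc j
  inBlock-decompose {k} {y} (off<y , y≤) = j , +-cancelˡ-≤ (off k) _ _ (subst (_≤ off k + lookup μ k) y≡ y≤) , y≡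
    where
    j : ℕ
    j = y ∸ suc (off k)
    y≡ : y ≡ off k + suc j
    y≡ = sym (trans (+-suc (off k) j) (m+[n∸m]≡n off<y))

  std-transpose : ∀ u {x z} v → x ≢ z →
    std μ (u ++ x ∷ z ∷ v) ≡ std μ u ++ label (u ʳ++ []) x ∷ label (u ʳ++ []) z ∷ stdAux μ (z ∷ x ∷ u ʳ++ []) v ×
    std μ (u ++ z ∷ x ∷ v) ≡ std μ u ++ label (u ʳ++ []) z ∷ label (u ʳ++ []) x ∷ stdAux μ (z ∷ x ∷ u ʳ++ []) v
  std-transpose u {x} {z} v x≢z =
    trans (stdAux-++ [] u _) (cong (λ k → std μ u ++ label U x ∷ off z + suc k ∷ Q) (count-there U (x≢z ∘ sym))) ,
    trans (stdAux-++ [] u _) (cong₂ (λ k r → std μ u ++ label U z ∷ off x + suc k ∷ r) (count-there U x≢z)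
                                    (stdAux-cong (λ c → count-swap c x z U) v))
    where
    U : List (Fin p)
    U = u ʳ++ []
    Q : List ℕ
    Q = stdAux μ (z ∷ x ∷ U) v

  std-permutation : ∀ w → InC μ w → IsPermutation n (std μ w)
  std-permutation w inC = record { unique = stdAux-unique [] w (≤-reflexive ∘ counts) ; range = range ; cover = cover }
    where
    counts : ∀ c → count c (w ʳ++ []) ≡ lookup μ c
    counts c = trans (count-ʳ++ c w []) (trans (+-identityʳ _) (inC c))
    range : ∀ {γ} → γ ∈ std μ w → 1 ≤ γ × γ ≤ n
    range γ∈ with stdAux-∈ [] w γ∈
    ... | c , j , _ , _ , j< , refl = inBlock-range (inBlock-+ (subst (j <_) (counts c) j<))
    cover : ∀ {γ} → 1 ≤ γ × γ ≤ n → γ ∈ std μ w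
    cover γ-range with block-of γ-range
    ... | k , b with inBlock-decompose b
    ...   | j , j< , refl = subst (λ i → off k + suc i ∈ std μ w) (+-identityʳ j)
                                  (stdAux-∋ [] w k (subst (j <_) (sym (inC k)) j<))

  module Colouring (d : Fin p) where

    cf : ℕ → Fin p
    cf y = fromMaybe d (col μ y)

    inBlock-cf : ∀ {k y} → InBlock k y → cf y ≡ k
    inBlock-cf b = cong (fromMaybe d) (inBlock-col b)

    cf-inBlock : ∀ {y} → 1 ≤ y × y ≤ n → InBlock (cf y) y
    cf-inBlock y-range with block-of y-range
    ... | k , b = subst (λ c → InBlock c _) (sym (inBlock-cf b)) b

    SameColourOrdered : List ℕ → Set
    SameColourOrdered σ = ∀ i → 1 ≤ i → suc i ≤ n → col μ i ≡ col μ (suc i) → Precedes i (suc i) σ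

    module _ {σ} (perm : IsPermutation n σ) (ordered : SameColourOrdered σ) where
      open IsPermutation perm

      block-ordered : ∀ {c y x} → InBlock c y → InBlock c x → y < x → Precedes y x σ
      block-ordered {c} {y} {x} by bx y<x =
        subst (λ z → Precedes y z σ) x≡ (chain (x ∸ suc y) by (subst (InBlock c) (sym x≡) bx))
        where
        x≡ : suc (x ∸ suc y) + y ≡ x
        x≡ = trans (sym (+-suc (x ∸ suc y) y)) (m∸n+n≡m y<x)
        consecutive : ∀ {z} → InBlock c z → InBlock c (suc z) → Precedes z (suc z) σ
        consecutive bz bz′ = ordered _ (proj₁ (inBlock-range bz)) (proj₂ (inBlock-range bz′))
                                     (trans (inBlock-col bz) (sym (inBlock-col bz′)))
        chain : ∀ k → InBlock c y → InBlock c (suc k + y) → Precedes y (suc k + y) σ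
        chain zero    by bx′ = consecutive by bx′
        chain (suc k) by bx′ = Precedes-trans unique (chain k by bk) (consecutive bk bx′)
          where
          bk : InBlock c (suc k + y)
          bk = <-≤-trans (proj₁ by) (m≤n+m y (suc k)) , ≤-trans (n≤1+n _) (proj₂ bx′)

      record Initial (A : List ℕ) (S : List (Fin p)) : Set where
        field
          segment→ : ∀ {c y} → InBlock c y → y ∈ A → y ≤ off c + count c S
          segment← : ∀ {c y} → InBlock c y → y ≤ off c + count c S → y ∈ A
          bounded  : ∀ c → count c S ≤ lookup μ c

      initial : Initial [] []
      initial = record
        { segment→ = λ _ ()
        ; segment← = λ b y≤ → contradiction (≤-trans y≤ (≤-reflexive (+-identityʳ _))) (<⇒≱ (proj₁ b))
        ; bounded = λ _ → z≤n }

      step : ∀ {A S x B} → σ ≡ A ++ x ∷ B → Initial A S → x ≡ label S (cf x) × Initial (A ++ x ∷ []) (cf x ∷ S)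
      step {A} {S} {x} {B} σ≡ I = x≡ , record { segment→ = segment→′ ; segment← = segment←′ ; bounded = bounded′ }
        where
        open Initial I
        c₀ : Fin p
        c₀ = cf x
        K : ℕ
        K = count c₀ S
        unique′ : Unique (A ++ x ∷ B)
        unique′ = subst Unique σ≡ unique
        bx : InBlock c₀ x
        bx = cf-inBlock (range x∈σ)
          where x∈σ = subst (x ∈_) (sym σ≡) (∈-++⁺ʳ A (here refl))
        above : off c₀ + K < x
        above = ≰⇒> λ x≤ → Unique-++⇒disjoint A unique′ (segment← bx x≤) (here refl)
        below : x ≤ off c₀ + suc K
        below = ≮⇒≥ λ y<x →
          let by = inBlock-+ (<⇒≤ (+-cancelˡ-< (off c₀) _ _ (<-≤-trans y<x (proj₂ bx))))
              y∈A = Precedes-before A unique′ (subst (Precedes _ x) σ≡ (block-ordered by bx y<x))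
          in <⇒≱ (+-monoʳ-< (off c₀) (n<1+n K)) (segment→ by y∈A)
        x≡ : x ≡ label S c₀
        x≡ = ≤-antisym below (≤-trans (≤-reflexive (+-suc (off c₀) K)) above)
        segment→′ : ∀ {c y} → InBlock c y → y ∈ A ++ x ∷ [] → y ≤ off c + count c (c₀ ∷ S)
        segment→′ {c} b y∈ with ∈-++⁻ A y∈
        ... | inj₁ y∈A = ≤-trans (segment→ b y∈A) (+-monoʳ-≤ (off c) (count-≤-∷ c c₀ S))
        ... | inj₂ (here refl) rewrite inBlock-unique b bx | count-here c₀ S = ≤-reflexive x≡
        segment←′ : ∀ {c y} → InBlock c y → y ≤ off c + count c (c₀ ∷ S) → y ∈ A ++ x ∷ []
        segment←′ {c} {y} b y≤ with c ≟ᶠ c₀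
        ... | no c≢c₀ = ∈-++⁺ˡ (segment← b y≤)
        ... | yes refl with y ≤? off c₀ + K
        ...   | yes y≤K = ∈-++⁺ˡ (segment← b y≤K)
        ...   | no y≰K  =
          ∈-++⁺ʳ A (here (trans (≤-antisym y≤ (≤-trans (≤-reflexive (+-suc (off c₀) K)) (≰⇒> y≰K))) (sym x≡)))
        bounded′ : ∀ c → count c (c₀ ∷ S) ≤ lookup μ c
        bounded′ c with c ≟ᶠ c₀
        ... | no _    = bounded c
        ... | yes refl = +-cancelˡ-≤ (off c₀) _ _ (subst (_≤ off c₀ + lookup μ c₀) x≡ (proj₂ bx))

      read : ∀ A B S → σ ≡ A ++ B → Initial A S → stdAux μ S (map cf B) ≡ B × Initial σ (map cf B ʳ++ S)
      read A []      S σ≡ I = refl , subst (λ L → Initial L S) (sym (trans σ≡ (++-identityʳ A))) I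
      read A (x ∷ B) S σ≡ I = cong₂ _∷_ (sym (proj₁ (step σ≡ I))) (proj₁ rest) , proj₂ rest
        where
        rest : stdAux μ (cf x ∷ S) (map cf B) ≡ B × Initial σ (map cf B ʳ++ cf x ∷ S)
        rest = read (A ++ x ∷ []) B (cf x ∷ S) (trans σ≡ (sym (++-assoc A (x ∷ []) B))) (proj₂ (step σ≡ I))

      std-colours : InC μ (map cf σ) × std μ (map cf σ) ≡ σ
      std-colours = inC , proj₁ (read [] σ [] refl initial)
        where
        open Initial (proj₂ (read [] σ [] refl initial))
        inC : InC μ (map cf σ)
        inC c = trans (sym (trans (count-ʳ++ c (map cf σ) []) (+-identityʳ _)))
                      (≤-antisym (bounded c) (≮⇒≥ λ count< →
                        let b = inBlock-+ count<
                        in <⇒≱ (+-monoʳ-< (off c) (n<1+n _)) (segment→ b (cover (inBlock-range b)))))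

-- Readings of a triangulation, region by region

Inside : ℕ → ℕ → Pair → Set
Inside a b (c , d) = a ≤ c × d ≤ b

Free : List ℕ → ℕ → ℕ → Set
Free R a b = ∀ {γ} → a ≤ γ → γ ≤ b → γ ∉ R

-- ∼ is instantiated to having the same colour, and tied to the second condition of IsSimple.
module Triangulation (n : ℕ) (T : DiagSet) (tri : IsTriangulation n T) (_∼_ : ℕ → ℕ → Set)
  (tied : ∀ i → 1 ≤ i → i < n → i ∼ suc i → ∀ t → Face n T t i (suc i) ⊎ Face n T i (suc i) t → t < i) where

  private
    diagonal : ∀ {e} → e ∈ T → IsDiag n e
    diagonal = proj₁ tri _
    crossing-free : ∀ {e f} → e ∈ T → f ∈ T → ¬ Cross e f
    crossing-free = proj₁ (proj₂ tri) _ _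
    maximal : ∀ {e} → IsDiag n e → (∀ f → f ∈ T → ¬ Cross e f) → e ∈ T
    maximal = proj₂ (proj₂ tri) _

  edge? : ∀ a b → Dec (Edge n T a b)
  edge? a b = (b ≟ suc a) ⊎-dec ((a ≟ 0) ×-dec (b ≟ suc n)) ⊎-dec ((a , b) ∈? T)
    where open import Data.List.Membership.DecPropositional (≡-dec _≟_ _≟_) using (_∈?_)

  Edge-crossing-free : ∀ {a b f} → Edge n T a b → f ∈ T → ¬ Cross (a , b) f
  Edge-crossing-free (inj₁ refl) _ (inj₁ (a<c , c<1+a , _)) = <⇒≱ a<c (≤-pred c<1+a)
  Edge-crossing-free (inj₁ refl) _ (inj₂ (_ , a<d , d<1+a)) = <⇒≱ a<d (≤-pred d<1+a)
  Edge-crossing-free (inj₂ (inj₁ (refl , refl))) f∈T (inj₁ (_ , _ , 1+n<d)) =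
    <⇒≱ 1+n<d (proj₁ (proj₂ (diagonal f∈T)))
  Edge-crossing-free (inj₂ (inj₂ e∈T)) f∈T = crossing-free e∈T f∈T

  Edge-∈ : ∀ {a b} → Edge n T a b → suc a < b → (a , b) ≢ (0 , suc n) → (a , b) ∈ T
  Edge-∈ (inj₁ refl)                1+a<b _     = contradiction 1+a<b (<-irrefl refl)
  Edge-∈ (inj₂ (inj₁ (refl , refl))) _     ≢root = contradiction refl ≢root
  Edge-∈ (inj₂ (inj₂ ab∈T))         _     _     = ab∈T

  Edge-≤ : ∀ {a b} → Edge n T a b → suc a < b → b ≤ suc n
  Edge-≤ (inj₁ refl)              1+a<b = contradiction 1+a<b (<-irrefl refl)
  Edge-≤ (inj₂ (inj₁ (_ , refl))) _     = ≤-refl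
  Edge-≤ (inj₂ (inj₂ ab∈T))       _     = proj₁ (proj₂ (diagonal ab∈T))

  private
    lastEdge : ∀ a j → a < j →
               ∃ λ m → a < m × m ≤ j × Edge n T a m × (∀ {m′} → m < m′ → m′ ≤ j → ¬ Edge n T a m′)
    lastEdge a (suc j) a<1+j with edge? a (suc j)
    ... | yes e = suc j , a<1+j , ≤-refl , e , λ m< m′≤ _ → <⇒≱ m< m′≤
    ... | no ¬e with lastEdge a j (≤∧≢⇒< (≤-pred a<1+j) λ { refl → ¬e (inj₁ refl) })
    ...   | m , a<m , m≤j , eam , last = m , a<m , m≤n⇒m≤1+n m≤j , eam , last′
      where
      last′ : ∀ {m′} → m < m′ → m′ ≤ suc j → ¬ Edge n T a m′
      last′ m<m′ m′≤1+j with m≤n⇒m<n∨m≡n m′≤1+j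
      ... | inj₁ m′<1+j = last m<m′ (≤-pred m′<1+j)
      ... | inj₂ refl   = ¬e

  -- The apex is the largest m < b joined to a; maximality of T joins it to b as well.
  apex : ∀ {a b} → suc a < b → b ≤ suc n → Edge n T a b → ∃ λ m → a < m × m < b × Edge n T a m × Edge n T m b
  apex {a} {suc j} 1+a<b b≤ eab with lastEdge a j (≤-pred 1+a<b)
  ... | m , a<m , m≤j , eam , last = m , a<m , s≤s m≤j , eam , emb
    where
    emb : Edge n T m (suc j)
    emb with suc j ≟ suc m
    ... | yes b≡ = inj₁ b≡
    ... | no b≢  =
      inj₂ (inj₂ (maximal (≤∧≢⇒< (s≤s m≤j) (b≢ ∘ sym) , b≤ , (λ { (refl , _) → n≮0 a<m })) no-cross))
      where
      no-cross : ∀ f → f ∈ T → ¬ Cross (m , suc j) f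
      no-cross (c , d) f∈T (inj₁ (m<c , c<b , b<d)) = Edge-crossing-free eab f∈T (inj₁ (<-trans a<m m<c , c<b , b<d))
      no-cross (c , d) f∈T (inj₂ (c<m , m<d , d<b)) with <-cmp c a
      ... | tri< c<a _ _  = Edge-crossing-free eab f∈T (inj₂ (c<a , <-trans a<m m<d , d<b))
      ... | tri≈ _ refl _ = last m<d (≤-pred d<b) (inj₂ (inj₂ f∈T))
      ... | tri> _ _ a<c  = Edge-crossing-free eam f∈T (inj₁ (a<c , c<m , m<d))

  Edge-below-apex : ∀ {a m b c d} → a < m → m < b → b ≤ suc n → Edge n T a m → Edge n T m b →
                    a ≤ c → d ≤ b → (c , d) ≢ (a , b) → Edge n T c d → d ≤ m ⊎ m ≤ c
  Edge-below-apex {a} {m} {b} {c} {d} a<m m<b b≤ eam emb a≤c d≤b cd≢ab ecd with d ≤? m | m ≤? c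
  ... | yes d≤m | _       = inj₁ d≤m
  ... | no _    | yes m≤c = inj₂ m≤c
  ... | no d≰m  | no m≰c  = ⊥-elim (crosses (m≤n⇒m<n∨m≡n a≤c))
    where
    c<m : c < m
    c<m = ≰⇒> m≰c
    m<d : m < d
    m<d = ≰⇒> d≰m
    cd∈T : (c , d) ∈ T
    cd∈T = Edge-∈ ecd (≤-<-trans c<m m<d) λ { refl → cd≢ab (cong₂ _,_ (sym (n≤0⇒n≡0 a≤c)) (≤-antisym d≤b b≤)) }
    crosses : a < c ⊎ a ≡ c → ⊥
    crosses (inj₁ a<c) = Edge-crossing-free eam cd∈T (inj₁ (a<c , c<m , m<d))
    crosses (inj₂ refl) with m≤n⇒m<n∨m≡n d≤b
    ... | inj₁ d<b  = Edge-crossing-free emb cd∈T (inj₂ (c<m , m<d , d<b))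
    ... | inj₂ refl = cd≢ab refl

  face-right-of : ∀ {m b} → Acc _<_ (b ∸ m) → suc m < b → b ≤ suc n → Edge n T m b →
                  ∃ λ t → suc m < t × Face n T m (suc m) t
  face-right-of {m} {b} (acc smaller) 1+m<b b≤ emb with apex 1+m<b b≤ emb
  ... | m′ , m<m′ , m′<b , emm′ , em′b with m′ ≟ suc m
  ...   | yes refl = b , 1+m<b , n<1+n m , 1+m<b , inj₁ refl , em′b , emb
  ...   | no m′≢  = face-right-of (smaller (∸-monoˡ-< m′<b (<⇒≤ m<m′))) (≤∧≢⇒< m<m′ (m′≢ ∘ sym))
                                  (≤-trans (<⇒≤ m′<b) b≤) emm′

  Below : ℕ → ℕ → Pair → Set
  Below a b e = (e ∈ T × Inside a b e) ⊎ (e ≡ (a , b) × suc a < b)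

  -- L is a removal order for the polygon cut off by the edge (a , b) of T.
  record Reads (a b : ℕ) (L : List ℕ) : Set where
    field
      mem→       : ∀ {γ} → γ ∈ L → Between a b γ
      mem←       : ∀ {γ} → Between a b γ → γ ∈ L
      unique     : Unique L
      diagonals≈ : ∀ {R} → Free R a b → ∀ e → (e ∈ diagonals n R L → Below a b e) × (Below a b e → e ∈ diagonals n R L)
      ordered    : ∀ {i} → a < i → suc i < b → i ∼ suc i → Precedes i (suc i) L

  record Reads₂ (a₁ b₁ a₂ b₂ : ℕ) (L : List ℕ) : Set where
    field
      mem→       : ∀ {γ} → γ ∈ L → Between a₁ b₁ γ ⊎ Between a₂ b₂ γ
      mem←       : ∀ {γ} → Between a₁ b₁ γ ⊎ Between a₂ b₂ γ → γ ∈ L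
      unique     : Unique L
      diagonals≈ : ∀ {R} → Free R a₁ b₁ → Free R a₂ b₂ → ∀ e →
                   (e ∈ diagonals n R L → Below a₁ b₁ e ⊎ Below a₂ b₂ e) ×
                   (Below a₁ b₁ e ⊎ Below a₂ b₂ e → e ∈ diagonals n R L)
      ordered    : ∀ {i} → (a₁ < i × suc i < b₁) ⊎ (a₂ < i × suc i < b₂) → i ∼ suc i → Precedes i (suc i) L

  reads-side : ∀ a → Reads a (suc a) []
  reads-side a = record
    { mem→ = λ ()
    ; mem← = λ (a<γ , γ<1+a) → contradiction (≤-pred γ<1+a) (<⇒≱ a<γ)
    ; unique = []
    ; diagonals≈ = λ _ e → (λ ()) , below
    ; ordered = λ a<i 1+i<1+a _ → contradiction (≤-pred (≤-trans (n≤1+n _) 1+i<1+a)) (<⇒≱ a<i) }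
    where
    below : ∀ {e} → Below a (suc a) e → e ∈ []
    below (inj₁ (e∈T , a≤c , d≤1+a)) = contradiction (≤-trans (proj₁ (diagonal e∈T)) d≤1+a) (<⇒≱ (s≤s (s≤s a≤c)))
    below (inj₂ (_ , 1+a<1+a))        = contradiction 1+a<1+a (<-irrefl refl)

  reads₂-swap : ∀ {a₁ b₁ a₂ b₂ L} → Reads₂ a₁ b₁ a₂ b₂ L → Reads₂ a₂ b₂ a₁ b₁ L
  reads₂-swap S = record
    { mem→ = Sum.swap ∘ mem→
    ; mem← = mem← ∘ Sum.swap
    ; unique = unique
    ; diagonals≈ = λ fr₂ fr₁ e →
        Sum.swap ∘ proj₁ (diagonals≈ fr₁ fr₂ e) , proj₂ (diagonals≈ fr₁ fr₂ e) ∘ Sum.swap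
    ; ordered = ordered ∘ Sum.swap }
    where open Reads₂ S

  reads₂-++ : ∀ {a₁ b₁ a₂ b₂ L₁ L₂} → Reads a₁ b₁ L₁ → Reads a₂ b₂ L₂ →
              (∀ {γ} → Between a₁ b₁ γ → γ < a₂ ⊎ b₂ < γ) → Reads₂ a₁ b₁ a₂ b₂ (L₁ ++ L₂)
  reads₂-++ {a₁} {b₁} {a₂} {b₂} {L₁} {L₂} S₁ S₂ apart = record
    { mem→ = Sum.map S₁.mem→ S₂.mem→ ∘ ∈-++⁻ L₁
    ; mem← = [ ∈-++⁺ˡ ∘ S₁.mem← , ∈-++⁺ʳ L₁ ∘ S₂.mem← ]′
    ; unique = Unique.++⁺ S₁.unique S₂.unique λ (γ∈L₁ , γ∈L₂) →
        [ <⇒≱ (proj₁ (S₂.mem→ γ∈L₂)) ∘ <⇒≤ , <⇒≱ (proj₂ (S₂.mem→ γ∈L₂)) ∘ <⇒≤ ]′ (apart (S₁.mem→ γ∈L₁))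
    ; diagonals≈ = diagonals≈
    ; ordered = [ (λ (a<i , 1+i<b) ∼ → Precedes-++ˡ L₁ L₂ (S₁.ordered a<i 1+i<b ∼))
                , (λ (a<i , 1+i<b) ∼ → Precedes-++ʳ L₁ (S₂.ordered a<i 1+i<b ∼)) ]′ }
    where
    module S₁ = Reads S₁
    module S₂ = Reads S₂
    diagonals≈ : ∀ {R} → Free R a₁ b₁ → Free R a₂ b₂ → ∀ e →
                 (e ∈ diagonals n R (L₁ ++ L₂) → Below a₁ b₁ e ⊎ Below a₂ b₂ e) ×
                 (Below a₁ b₁ e ⊎ Below a₂ b₂ e → e ∈ diagonals n R (L₁ ++ L₂))
    diagonals≈ {R} fr₁ fr₂ e = forth , back
      where
      fr₂′ : Free (L₁ ʳ++ R) a₂ b₂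
      fr₂′ a₂≤γ γ≤b₂ γ∈ with ∈-ʳ++⁻ L₁ R γ∈
      ... | inj₁ γ∈L₁ =
        [ (λ γ<a₂ → <⇒≱ γ<a₂ a₂≤γ) , (λ b₂<γ → <⇒≱ b₂<γ γ≤b₂) ]′ (apart (S₁.mem→ γ∈L₁))
      ... | inj₂ γ∈R  = fr₂ a₂≤γ γ≤b₂ γ∈R
      forth : e ∈ diagonals n R (L₁ ++ L₂) → Below a₁ b₁ e ⊎ Below a₂ b₂ e
      forth e∈ with ∈-++⁻ (diagonals n R L₁) (subst (e ∈_) (diagonals-++ n R L₁ L₂) e∈)
      ... | inj₁ e∈₁ = inj₁ (proj₁ (S₁.diagonals≈ fr₁ e) e∈₁)
      ... | inj₂ e∈₂ = inj₂ (proj₁ (S₂.diagonals≈ fr₂′ e) e∈₂)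
      back : Below a₁ b₁ e ⊎ Below a₂ b₂ e → e ∈ diagonals n R (L₁ ++ L₂)
      back = subst (e ∈_) (sym (diagonals-++ n R L₁ L₂)) ∘
             [ ∈-++⁺ˡ ∘ proj₂ (S₁.diagonals≈ fr₁ e)
             , ∈-++⁺ʳ (diagonals n R L₁) ∘ proj₂ (S₂.diagonals≈ fr₂′ e) ]′

  reads-apex : ∀ {a m b L} → a < m → m < b → b ≤ suc n → Edge n T a m → Edge n T m b →
               Reads₂ a m m b L → Reads a b (L ++ m ∷ [])
  reads-apex {a} {m} {b} {L} a<m m<b b≤ eam emb S = record
    { mem→ = mem→′ ; mem← = mem←′ ; unique = unique′ ; diagonals≈ = diagonals≈′ ; ordered = ordered′ }
    where
    open Reads₂ S
    widen : ∀ {γ} → Between a m γ ⊎ Between m b γ → Between a b γ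
    widen (inj₁ (a<γ , γ<m)) = a<γ , <-trans γ<m m<b
    widen (inj₂ (m<γ , γ<b)) = <-trans a<m m<γ , γ<b

    m∉L : m ∉ L
    m∉L m∈L = [ <-irrefl refl ∘ proj₂ , <-irrefl refl ∘ proj₁ ]′ (mem→ m∈L)

    mem→′ : ∀ {γ} → γ ∈ L ++ m ∷ [] → Between a b γ
    mem→′ γ∈ with ∈-++⁻ L γ∈
    ... | inj₁ γ∈L      = widen (mem→ γ∈L)
    ... | inj₂ (here refl) = a<m , m<b

    mem←′ : ∀ {γ} → Between a b γ → γ ∈ L ++ m ∷ []
    mem←′ {γ} (a<γ , γ<b) with <-cmp γ m
    ... | tri< γ<m _ _ = ∈-++⁺ˡ (mem← (inj₁ (a<γ , γ<m)))
    ... | tri≈ _ γ≡m _ = ∈-++⁺ʳ L (here γ≡m)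
    ... | tri> _ _ m<γ = ∈-++⁺ˡ (mem← (inj₂ (m<γ , γ<b)))

    unique′ : Unique (L ++ m ∷ [])
    unique′ = Unique.++⁺ unique (All.[] ∷ []) λ { (γ∈L , here refl) → m∉L γ∈L }

    dg-m : ∀ {R} → Free R a b → dg n (L ʳ++ R) m ≡ (a , b)
    dg-m {R} fr = dg-eq record
      { α<x = a<m ; x<β = m<b ; β≤1+n = b≤
      ; α∉R = kept ≤-refl (<⇒≤ (<-trans a<m m<b)) (λ a∈L → <-irrefl refl (proj₁ (widen (mem→ a∈L))))
      ; β∉R = kept (<⇒≤ (<-trans a<m m<b)) ≤-refl (λ b∈L → <-irrefl refl (proj₂ (widen (mem→ b∈L))))
      ; removed = λ γ a<γ γ<b γ≢m → ∈-ʳ++⁺ L R (inj₁ (∈-++⁻ˡ (mem←′ (a<γ , γ<b)) γ≢m)) }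
      where
      kept : ∀ {y} → a ≤ y → y ≤ b → y ∉ L → y ∉ L ʳ++ R
      kept a≤y y≤b y∉L y∈ = [ y∉L , fr a≤y y≤b ]′ (∈-ʳ++⁻ L R y∈)
      ∈-++⁻ˡ : ∀ {γ} → γ ∈ L ++ m ∷ [] → γ ≢ m → γ ∈ L
      ∈-++⁻ˡ γ∈ γ≢m = [ (λ γ∈L → γ∈L) , (λ { (here γ≡m) → contradiction γ≡m γ≢m }) ]′ (∈-++⁻ L γ∈)

    root-free : (a , m) ≢ (0 , suc n) × (m , b) ≢ (0 , suc n)
    root-free = (λ { refl → <⇒≱ m<b b≤ }) , (λ { refl → n≮0 a<m })

    narrow : ∀ {e} → Below a m e ⊎ Below m b e → Below a b e
    narrow (inj₁ (inj₁ (e∈T , a≤c , d≤m))) = inj₁ (e∈T , a≤c , ≤-trans d≤m (<⇒≤ m<b))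
    narrow (inj₁ (inj₂ (refl , 1+a<m)))    = inj₁ (Edge-∈ eam 1+a<m (proj₁ root-free) , ≤-refl , <⇒≤ m<b)
    narrow (inj₂ (inj₁ (e∈T , m≤c , d≤b))) = inj₁ (e∈T , ≤-trans (<⇒≤ a<m) m≤c , d≤b)
    narrow (inj₂ (inj₂ (refl , 1+m<b)))    = inj₁ (Edge-∈ emb 1+m<b (proj₂ root-free) , <⇒≤ a<m , ≤-refl)

    diagonals≈′ : ∀ {R} → Free R a b → ∀ e →
                  (e ∈ diagonals n R (L ++ m ∷ []) → Below a b e) × (Below a b e → e ∈ diagonals n R (L ++ m ∷ []))
    diagonals≈′ {R} fr e = forth , back
      where
      fr₁ : Free R a m
      fr₁ a≤γ γ≤m = fr a≤γ (≤-trans γ≤m (<⇒≤ m<b))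
      fr₂ : Free R m b
      fr₂ m≤γ γ≤b = fr (≤-trans (<⇒≤ a<m) m≤γ) γ≤b
      split : diagonals n R (L ++ m ∷ []) ≡ diagonals n R L ++ (a , b) ∷ []
      split = trans (diagonals-++ n R L (m ∷ [])) (cong (λ d → diagonals n R L ++ d ∷ []) (dg-m fr))
      forth : e ∈ diagonals n R (L ++ m ∷ []) → Below a b e
      forth e∈ with ∈-++⁻ (diagonals n R L) (subst (e ∈_) split e∈)
      ... | inj₁ e∈L         = narrow (proj₁ (diagonals≈ fr₁ fr₂ e) e∈L)
      ... | inj₂ (here refl) = inj₂ (refl , ≤-<-trans a<m m<b)
      back : Below a b e → e ∈ diagonals n R (L ++ m ∷ [])
      back below = subst (e ∈_) (sym split) (back′ below)
        where
        back′ : Below a b e → e ∈ diagonals n R L ++ (a , b) ∷ []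
        back′ (inj₂ (refl , _)) = ∈-++⁺ʳ _ (here refl)
        back′ (inj₁ (e∈T , a≤c , d≤b)) with ≡-dec _≟_ _≟_ e (a , b)
        ... | yes refl = ∈-++⁺ʳ _ (here refl)
        ... | no e≢ab  = ∈-++⁺ˡ (proj₂ (diagonals≈ fr₁ fr₂ e)
              (Sum.map (λ d≤m → inj₁ (e∈T , a≤c , d≤m)) (λ m≤c → inj₁ (e∈T , m≤c , d≤b))
                       (Edge-below-apex a<m m<b b≤ eam emb a≤c d≤b e≢ab (inj₂ (inj₂ e∈T)))))

    ordered′ : ∀ {i} → a < i → suc i < b → i ∼ suc i → Precedes i (suc i) (L ++ m ∷ [])
    ordered′ {i} a<i 1+i<b i∼ with <-cmp (suc i) m
    ... | tri< 1+i<m _ _ = Precedes-++ˡ L _ (ordered (inj₁ (a<i , 1+i<m)) i∼)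
    ... | tri≈ _ refl _  = Precedes-++ L _ (mem← (inj₁ (a<i , ≤-refl))) (here refl)
    ... | tri> _ _ m<1+i with m≤n⇒m<n∨m≡n (≤-pred m<1+i)
    ...   | inj₁ m<i  = Precedes-++ˡ L _ (ordered (inj₂ (m<i , 1+i<b)) i∼)
    ...   | inj₂ refl with face-right-of (<-wellFounded _) 1+i<b b≤ emb
    ...     | t , 1+m<t , face = contradiction (tied m (≤-<-trans z≤n a<m) (≤-pred (<-≤-trans 1+i<b b≤)) i∼ t (inj₂ face))
                                                (<⇒≱ (<-trans (n<1+n m) 1+m<t) ∘ <⇒≤)

  reads-below : ∀ {a b} → Acc _<_ (b ∸ a) → a < b → b ≤ suc n → Edge n T a b → ∃ (Reads a b)
  reads-below {a} {b} (acc smaller) a<b b≤ eab with b ≟ suc a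
  ... | yes refl = [] , reads-side a
  ... | no b≢ with apex (≤∧≢⇒< a<b (b≢ ∘ sym)) b≤ eab
  ...   | m , a<m , m<b , eam , emb
          with reads-below (smaller (∸-monoˡ-< m<b (<⇒≤ a<m))) a<m (≤-trans (<⇒≤ m<b) b≤) eam
             | reads-below (smaller (∸-monoʳ-< a<m (<⇒≤ m<b))) m<b b≤ emb
  ...     | L₁ , S₁ | L₂ , S₂ =
    (L₁ ++ L₂) ++ m ∷ [] , reads-apex a<m m<b b≤ eam emb (reads₂-++ S₁ S₂ λ (_ , γ<m) → inj₁ γ<m)

  private
    proper : ∀ {a b c d} → a ≤ c → c < d → d ≤ b → (c , d) ≢ (a , b) → suc a < b
    proper {a} {b} {c} {d} a≤c c<d d≤b cd≢ab = ≤∧≢⇒< (≤-<-trans a≤c (<-≤-trans c<d d≤b)) λ 1+a≡b →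
      cd≢ab (cong₂ _,_ (≤-antisym (≤-pred (≤-trans (<-≤-trans c<d d≤b) (≤-reflexive (sym 1+a≡b)))) a≤c)
                       (≤-antisym d≤b (≤-trans (≤-reflexive (sym 1+a≡b)) (≤-trans (s≤s a≤c) c<d))))

    reassociate : ∀ (M P L : List ℕ) m → ((M ++ P) ++ L) ++ m ∷ [] ≡ M ++ P ++ L ++ m ∷ []
    reassociate M P L m = trans (++-assoc (M ++ P) L (m ∷ [])) (++-assoc M P (L ++ m ∷ []))

  reads-extension : ∀ {a b c d} → Acc _<_ (b ∸ a) → a ≤ c → c < d → d ≤ b → b ≤ suc n →
                    Edge n T a b → Edge n T c d →
         ∃ λ Post → ∀ {M} → Reads c d M → Reads a b (M ++ Post)
  reads-extension {a} {b} {c} {d} (acc smaller) a≤c c<d d≤b b≤ eab ecd with ≡-dec _≟_ _≟_ (c , d) (a , b)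
  ... | yes refl = [] , λ {M} S → subst (Reads c d) (sym (++-identityʳ M)) S
  ... | no cd≢ab with apex (proper a≤c c<d d≤b cd≢ab) b≤ eab
  ...   | m , a<m , m<b , eam , emb with Edge-below-apex a<m m<b b≤ eam emb a≤c d≤b cd≢ab ecd
  ...     | inj₁ d≤m
    with reads-extension (smaller (∸-monoˡ-< m<b (<⇒≤ a<m))) a≤c c<d d≤m (≤-trans (<⇒≤ m<b) b≤) eam ecd
       | reads-below (<-wellFounded _) m<b b≤ emb
  ...       | Post , extend | L₂ , S₂ = Post ++ L₂ ++ m ∷ [] , λ {M} S →
    subst (Reads a b) (reassociate M Post L₂ m)
          (reads-apex a<m m<b b≤ eam emb (reads₂-++ (extend S) S₂ λ (_ , γ<m) → inj₁ γ<m))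
  reads-extension {a} {b} {c} {d} (acc smaller) a≤c c<d d≤b b≤ eab ecd | no cd≢ab | m , a<m , m<b , eam , emb | inj₂ m≤c
    with reads-extension (smaller (∸-monoʳ-< a<m (<⇒≤ m<b))) m≤c c<d d≤b b≤ emb ecd
       | reads-below (<-wellFounded _) a<m (≤-trans (<⇒≤ m<b) b≤) eam
  ... | Post , extend | L₁ , S₁ = Post ++ L₁ ++ m ∷ [] , λ {M} S →
    subst (Reads a b) (reassociate M Post L₁ m)
          (reads-apex a<m m<b b≤ eam emb (reads₂-swap (reads₂-++ (extend S) S₁ λ (m<γ , _) → inj₂ m<γ)))

  reads-φ : ∀ {σ} → Reads 0 (suc n) σ → 1 ≤ n → φ n σ ≈ˢ T
  reads-φ {σ} S 1≤n with initLast σ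
  ... | [] = contradiction (Reads.mem← S (s≤s z≤n , s≤s 1≤n)) λ ()
  ... | L ∷ʳ′ m = λ e → sound ∘ subst (e ∈_) φ≡ , subst (e ∈_) (sym φ≡) ∘ complete
    where
    open Reads S
    φ≡ : φ n (L ++ m ∷ []) ≡ diagonals n [] L
    φ≡ = phiAux-∷ʳ n [] L m
    split : diagonals n [] (L ++ m ∷ []) ≡ diagonals n [] L ++ dg n (L ʳ++ []) m ∷ []
    split = diagonals-++ n [] L (m ∷ [])

    to-Below : ∀ {e} → e ∈ diagonals n [] L → Below 0 (suc n) e
    to-Below {e} e∈ = proj₁ (diagonals≈ (λ _ _ ()) e) (subst (e ∈_) (sym split) (∈-++⁺ˡ e∈))
    from-Below : ∀ {e} → Below 0 (suc n) e → e ∈ diagonals n [] L ⊎ e ≡ dg n (L ʳ++ []) m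
    from-Below {e} below with ∈-++⁻ (diagonals n [] L) (subst (e ∈_) split (proj₂ (diagonals≈ (λ _ _ ()) e) below))
    ... | inj₁ e∈L      = inj₁ e∈L
    ... | inj₂ (here e≡) = inj₂ e≡

    m-inside : Between 0 (suc n) m
    m-inside = mem→ (∈-++⁺ʳ L (here refl))
    -- The last vertex contributes the root (0 , suc n), which φ omits and T does not contain.
    root∉ : (0 , suc n) ∉ diagonals n [] L
    root∉ root∈ with diagonals-interior n [] L root∈ (proj₁ m-inside) (proj₂ m-inside)
    ... | inj₂ m∈L = Unique-++⇒disjoint L unique m∈L (here refl)

    sound : ∀ {e} → e ∈ diagonals n [] L → e ∈ T
    sound e∈ with to-Below e∈
    ... | inj₁ (e∈T , _)  = e∈T
    ... | inj₂ (refl , _) = contradiction e∈ root∉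

    complete : ∀ {e} → e ∈ T → e ∈ diagonals n [] L
    complete e∈T with from-Below (inj₁ (e∈T , z≤n , proj₁ (proj₂ (diagonal e∈T)))) | from-Below (inj₂ (refl , s≤s 1≤n))
    ... | inj₁ e∈L      | _               = e∈L
    ... | inj₂ _        | inj₁ root∈L     = contradiction root∈L root∉
    ... | inj₂ e≡last   | inj₂ root≡last  =
      contradiction (refl , refl) (proj₂ (proj₂ (diagonal (subst (_∈ T) (trans e≡last (sym root≡last)) e∈T))))

-- Switched flips and switched readings

SwitchedReadings : ∀ {p} → Vec ℕ p → DiagSet → DiagSet → Set
SwitchedReadings μ T T′ =
  ∃[ w ] ∃[ w′ ] ∃[ u ] ∃[ v ] ∃[ x ] ∃[ z ]
    (IsReading μ T w × IsReading μ T′ w′ × w ≡ u ++ x ∷ z ∷ v × w′ ≡ u ++ z ∷ x ∷ v × x ≢ z ×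
     All (λ y → ¬ (x ≤ᶠ y × y <ᶠ z) × ¬ (z ≤ᶠ y × y <ᶠ x)) v)

SwitchedReadings-sym : ∀ {p} {μ : Vec ℕ p} {T T′} → SwitchedReadings μ T T′ → SwitchedReadings μ T′ T
SwitchedReadings-sym (w , w′ , u , v , x , z , r , r′ , w≡ , w′≡ , x≢z , outside) =
  w′ , w , u , v , z , x , r′ , r , w′≡ , w≡ , x≢z ∘ sym , All.map Product.swap outside

record DiagonalFlip (n : ℕ) (T T′ : DiagSet) (q₁ q₂ q₃ q₄ : ℕ) : Set where
  field
    diagonal₁₃ : (q₁ , q₃) ∈ T
    side₁₂     : Edge n T q₁ q₂
    side₂₃     : Edge n T q₂ q₃
    side₃₄     : Edge n T q₃ q₄
    side₁₄     : Edge n T q₁ q₄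
    replace    : Replace T (q₁ , q₃) (q₂ , q₄) T′

Edge-replace : ∀ {n T T′ d d′ a b} → Replace T d d′ T′ → (a , b) ≢ d → Edge n T a b → Edge n T′ a b
Edge-replace r ab≢d (inj₁ side)         = inj₁ side
Edge-replace r ab≢d (inj₂ (inj₁ outer)) = inj₂ (inj₁ outer)
Edge-replace r ab≢d (inj₂ (inj₂ ab∈T))  = inj₂ (inj₂ (proj₂ (r _) (inj₂ (ab∈T , ab≢d))))

Replace-sym : ∀ {T T′ d d′} → d ∈ T → d′ ∉ T → Replace T d d′ T′ → Replace T′ d′ d T
Replace-sym {T} {T′} {d} {d′} d∈T d′∉T r e = forth , back
  where
  forth : e ∈ T → e ≡ d ⊎ (e ∈ T′ × e ≢ d′)
  forth e∈T with ≡-dec _≟_ _≟_ e d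
  ... | yes e≡d = inj₁ e≡d
  ... | no e≢d  = inj₂ (proj₂ (r e) (inj₂ (e∈T , e≢d)) , λ { refl → d′∉T e∈T })
  back : e ≡ d ⊎ (e ∈ T′ × e ≢ d′) → e ∈ T
  back (inj₁ refl) = d∈T
  back (inj₂ (e∈T′ , e≢d′)) with proj₁ (r e) e∈T′
  ... | inj₁ e≡d′       = contradiction e≡d′ e≢d′
  ... | inj₂ (e∈T , _) = e∈T

flip-of-faces₁ : ∀ {n T T′ q₁ q₂ q₃ q₄} → (q₁ , q₃) ∈ T → Face n T q₁ q₂ q₃ → Face n T q₁ q₃ q₄ →
                 Replace T (q₁ , q₃) (q₂ , q₄) T′ → DiagonalFlip n T T′ q₁ q₂ q₃ q₄
flip-of-faces₁ d∈T (_ , _ , e₁₂ , e₂₃ , _) (_ , _ , _ , e₃₄ , e₁₄) r = record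
  { diagonal₁₃ = d∈T ; side₁₂ = e₁₂ ; side₂₃ = e₂₃ ; side₃₄ = e₃₄ ; side₁₄ = e₁₄ ; replace = r }

flip-of-faces₂ : ∀ {n T T′ q₁ q₂ q₃ q₄} → IsTriangulation n T → q₁ < q₂ → q₂ < q₃ → q₃ < q₄ →
                 (q₂ , q₄) ∈ T → Face n T q₁ q₂ q₄ → Face n T q₂ q₃ q₄ →
                 Replace T (q₂ , q₄) (q₁ , q₃) T′ → DiagonalFlip n T′ T q₁ q₂ q₃ q₄
flip-of-faces₂ tri q₁<q₂ q₂<q₃ q₃<q₄ d∈T (_ , _ , e₁₂ , _ , e₁₄) (_ , _ , e₂₃ , e₃₄ , _) r = record
  { diagonal₁₃ = proj₂ (r _) (inj₁ refl)
  ; side₁₂ = Edge-replace r (<⇒≢ q₁<q₂ ∘ cong proj₁) e₁₂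
  ; side₂₃ = Edge-replace r (<⇒≢ q₃<q₄ ∘ cong proj₂) e₂₃
  ; side₃₄ = Edge-replace r (>⇒≢ q₂<q₃ ∘ cong proj₁) e₃₄
  ; side₁₄ = Edge-replace r (<⇒≢ q₁<q₂ ∘ cong proj₁) e₁₄
  ; replace = Replace-sym d∈T (λ q₁q₃∈T → proj₁ (proj₂ tri) _ _ q₁q₃∈T d∈T (inj₁ (q₁<q₂ , q₂<q₃ , q₃<q₄))) r
  }

module Readings {p} (μ : Vec ℕ p) where
  open Colours μ

  label-inBlock : ∀ {c} u {r} → InC μ (u ++ r) → c ∈ r → InBlock c (label (u ʳ++ []) c)
  label-inBlock {c} u {r} inC c∈r = inBlock-+ (begin-strict
    count c (u ʳ++ [])       ≡⟨ trans (count-ʳ++ c u []) (+-identityʳ (count c u)) ⟩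
    count c u                <⟨ m<m+n (count c u) (count-pos c∈r) ⟩
    count c u + count c r    ≡⟨ count-++ c u r ⟨
    count c (u ++ r)         ≡⟨ inC c ⟩
    lookup μ c               ∎)
    where open ≤-Reasoning

  module ReadingsToFlip {T T′ u v x z} (x<z : x <ᶠ z)
    (reading : IsReading μ T (u ++ x ∷ z ∷ v)) (reading′ : IsReading μ T′ (u ++ z ∷ x ∷ v))
    (outside : All (λ y → ¬ (x ≤ᶠ y × y <ᶠ z) × ¬ (z ≤ᶠ y × y <ᶠ x)) v) where

    x≢z : x ≢ z
    x≢z refl = <-irrefl refl x<z

    U : List (Fin p)
    U = u ʳ++ []
    a b : ℕ
    a = label U x
    b = label U z
    P Q : List ℕ
    P = std μ u
    Q = stdAux μ (z ∷ x ∷ U) v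

    std-w : std μ (u ++ x ∷ z ∷ v) ≡ P ++ a ∷ b ∷ Q
    std-w = proj₁ (std-transpose u v x≢z)
    std-w′ : std μ (u ++ z ∷ x ∷ v) ≡ P ++ b ∷ a ∷ Q
    std-w′ = proj₂ (std-transpose u v x≢z)
    open IsPermutation (subst (IsPermutation n) std-w (std-permutation _ (proj₁ reading)))

    a∈x : InBlock x a
    a∈x = label-inBlock u (proj₁ reading) (here refl)
    b∈z : InBlock z b
    b∈z = label-inBlock u (proj₁ reading) (there (here refl))
    a<b : a < b
    a<b = inBlock-< a∈x b∈z x<z
    b≤n : b ≤ n
    b≤n = proj₂ (inBlock-range b∈z)
    a≁b : col μ a ≢ col μ b
    a≁b eq = x≢z (just-injective (trans (sym (inBlock-col a∈x)) (trans eq (inBlock-col b∈z))))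
    a∉P : a ∉ P
    a∉P a∈P = Unique-++⇒disjoint P unique a∈P (here refl)
    b∉P : b ∉ P
    b∉P b∈P = Unique-++⇒disjoint P unique b∈P (there (here refl))

    all-letters : ∀ c → count c (v ʳ++ z ∷ x ∷ U) ≡ lookup μ c
    all-letters c = begin
      count c (v ʳ++ z ∷ x ∷ U)              ≡⟨ cong (count c) (++-ʳ++ u) ⟨
      count c ((u ++ x ∷ z ∷ v) ʳ++ [])      ≡⟨ count-ʳ++ c (u ++ x ∷ z ∷ v) [] ⟩
      count c (u ++ x ∷ z ∷ v) + 0           ≡⟨ +-identityʳ _ ⟩
      count c (u ++ x ∷ z ∷ v)               ≡⟨ proj₁ reading c ⟩
      lookup μ c                             ∎
      where open ≡-Reasoning

    -- The letters of v avoid the colours in [x , z), so they are labelled outside (a , b).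
    Q-outside : ∀ {γ} → γ ∈ Q → ¬ Between a b γ
    Q-outside γ∈Q (a<γ , γ<b) with stdAux-∈ (z ∷ x ∷ U) v γ∈Q
    ... | c , j , c∈v , ≤j , j< , refl with FP.<-cmp c x | FP.<-cmp c z
    ...   | tri< c<x _ _ | _ = <-asym a<γ (inBlock-< (inBlock-+ (subst (j <_) (all-letters c) j<)) a∈x c<x)
    ...   | tri≈ _ refl _ | _ = proj₁ (All.lookup outside c∈v) (≤-refl , x<z)
    ...   | tri> _ _ x<c | tri< c<z _ _ = proj₁ (All.lookup outside c∈v) (<⇒≤ x<c , c<z)
    ...   | tri> _ _ _ | tri≈ _ refl _ = <-asym γ<b (+-monoʳ-< (off z) (s≤s (subst (_≤ j) count-z ≤j)))
      where
      count-z : count z (z ∷ x ∷ U) ≡ suc (count z U)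
      count-z = trans (count-here z (x ∷ U)) (cong suc (count-there U (x≢z ∘ sym)))
    ...   | tri> _ _ _ | tri> _ _ z<c = <-asym γ<b (inBlock-< b∈z (inBlock-+ (subst (j <_) (all-letters c) j<)) z<c)

    between : ∀ {γ} → Between a b γ → γ ∈ P
    between (a<γ , γ<b) with ∈-++⁻ P (cover (≤-trans (s≤s z≤n) a<γ , ≤-trans (<⇒≤ γ<b) b≤n))
    ... | inj₁ γ∈P = γ∈P
    ... | inj₂ (here refl) = contradiction a<γ (<-irrefl refl)
    ... | inj₂ (there (here refl)) = contradiction γ<b (<-irrefl refl)
    ... | inj₂ (there (there γ∈Q)) = contradiction (a<γ , γ<b) (Q-outside γ∈Q)

    open GapAround (gap-around P (range ∘ ∈-++⁺ˡ) (proj₁ (inBlock-range a∈x)) b≤n)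

    filled : ∀ γ → Between α β γ → γ ≢ a → γ ≢ b → γ ∈ P
    filled γ (α<γ , γ<β) γ≢a γ≢b with <-cmp γ a | <-cmp γ b
    ... | tri< γ<a _ _ | _            = below (α<γ , γ<a)
    ... | tri≈ _ γ≡a _ | _            = contradiction γ≡a γ≢a
    ... | tri> _ _ a<γ | tri< γ<b _ _ = between (a<γ , γ<b)
    ... | tri> _ _ _   | tri≈ _ γ≡b _ = contradiction γ≡b γ≢b
    ... | tri> _ _ _   | tri> _ _ b<γ = above (b<γ , γ<β)

    flips : SwitchedFlip μ T T′ × SwitchedFlip μ T′ T
    flips = transposition-flips μ (transposition n P Q α<a a<b b<β β≤1+n α∉P a∉P b∉P β∉P filled cover)
              α<a a<b b<β a≁b (subst (λ σ → φ n σ ≈ˢ T) std-w (proj₂ reading))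
                              (subst (λ σ → φ n σ ≈ˢ T′) std-w′ (proj₂ reading′))

  outside-interval : ∀ {x z c : Fin p} → x ≤ᶠ z → c <ᶠ x ⊎ z ≤ᶠ c →
                     ¬ (x ≤ᶠ c × c <ᶠ z) × ¬ (z ≤ᶠ c × c <ᶠ x)
  outside-interval x≤z (inj₁ c<x) = (λ (x≤c , _) → <⇒≱ c<x x≤c) , (λ (z≤c , _) → <⇒≱ c<x (≤-trans x≤z z≤c))
  outside-interval x≤z (inj₂ z≤c) = (λ (_ , c<z) → <⇒≱ c<z z≤c) , (λ (_ , c<x) → <⇒≱ c<x (≤-trans x≤z z≤c))

  module FlipToReadings {T T′ q₁ q₂ q₃ q₄} (tri : IsTriangulation n T) (simple : IsSimple μ T)
    (q₁<q₂ : q₁ < q₂) (q₂<q₃ : q₂ < q₃) (q₃<q₄ : q₃ < q₄) (q₂≁q₃ : col μ q₂ ≢ col μ q₃)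
    (F : DiagonalFlip n T T′ q₁ q₂ q₃ q₄) where

    open DiagonalFlip F
    open Triangulation n T tri (λ i j → col μ i ≡ col μ j) (proj₂ simple)

    q₁<q₃ : q₁ < q₃
    q₁<q₃ = <-trans q₁<q₂ q₂<q₃
    q₄≤ : q₄ ≤ suc n
    q₄≤ = Edge-≤ side₁₄ (≤-<-trans q₁<q₂ (<-trans q₂<q₃ q₃<q₄))
    q₃≤ : q₃ ≤ suc n
    q₃≤ = ≤-trans (<⇒≤ q₃<q₄) q₄≤
    q₂-range : 1 ≤ q₂ × q₂ ≤ n
    q₂-range = ≤-<-trans z≤n q₁<q₂ , ≤-pred (<-≤-trans q₂<q₃ q₃≤)
    q₃-range : 1 ≤ q₃ × q₃ ≤ n
    q₃-range = ≤-<-trans z≤n q₁<q₃ , ≤-pred (<-≤-trans q₃<q₄ q₄≤)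

    R₁₂ : ∃ (Reads q₁ q₂)
    R₁₂ = reads-below (<-wellFounded _) q₁<q₂ (m≤n⇒m≤1+n (proj₂ q₂-range)) side₁₂
    R₂₃ : ∃ (Reads q₂ q₃)
    R₂₃ = reads-below (<-wellFounded _) q₂<q₃ q₃≤ side₂₃
    R₃₄ : ∃ (Reads q₃ q₄)
    R₃₄ = reads-below (<-wellFounded _) q₃<q₄ q₄≤ side₃₄

    Pre : List ℕ
    Pre = proj₁ R₃₄ ++ proj₁ R₁₂ ++ proj₁ R₂₃

    -- Read everything below the sides of the quadrilateral first, then q₂ and q₃.
    quadrilateral : Reads q₁ q₄ (Pre ++ q₂ ∷ q₃ ∷ [])
    quadrilateral = subst (Reads q₁ q₄) reassociate
      (reads-apex q₁<q₃ q₃<q₄ q₄≤ (inj₂ (inj₂ diagonal₁₃)) side₃₄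
        (reads₂-swap (reads₂-++ (proj₂ R₃₄) triangle λ (q₃<γ , _) → inj₂ q₃<γ)))
      where
      triangle : Reads q₁ q₃ ((proj₁ R₁₂ ++ proj₁ R₂₃) ++ q₂ ∷ [])
      triangle = reads-apex q₁<q₂ q₂<q₃ q₃≤ side₁₂ side₂₃
                   (reads₂-++ (proj₂ R₁₂) (proj₂ R₂₃) λ (_ , γ<q₂) → inj₁ γ<q₂)
      reassociate : (proj₁ R₃₄ ++ (proj₁ R₁₂ ++ proj₁ R₂₃) ++ q₂ ∷ []) ++ q₃ ∷ [] ≡ Pre ++ q₂ ∷ q₃ ∷ []
      reassociate = trans (++-assoc (proj₁ R₃₄) _ (q₃ ∷ []))
                   (trans (cong (proj₁ R₃₄ ++_) (++-assoc (proj₁ R₁₂ ++ proj₁ R₂₃) (q₂ ∷ []) (q₃ ∷ [])))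
                          (sym (++-assoc (proj₁ R₃₄) _ _)))
    module Q = Reads quadrilateral

    completion : ∃ λ Post → ∀ {M} → Reads q₁ q₄ M → Reads 0 (suc n) (M ++ Post)
    completion = reads-extension (<-wellFounded _) z≤n (<-trans q₁<q₃ q₃<q₄) q₄≤ ≤-refl
                                 (inj₂ (inj₁ (refl , refl))) side₁₄
    Post : List ℕ
    Post = proj₁ completion
    whole : Reads 0 (suc n) ((Pre ++ q₂ ∷ q₃ ∷ []) ++ Post)
    whole = proj₂ completion quadrilateral

    σ : List ℕ
    σ = Pre ++ q₂ ∷ q₃ ∷ Post
    σ-reads : Reads 0 (suc n) σ
    σ-reads = subst (Reads 0 (suc n)) (++-assoc Pre (q₂ ∷ q₃ ∷ []) Post) whole
    φσ≈T : φ n σ ≈ˢ T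
    φσ≈T = reads-φ σ-reads (≤-trans (proj₁ q₂-range) (proj₂ q₂-range))

    perm : IsPermutation n σ
    perm = record
      { unique = Reads.unique σ-reads
      ; range = λ γ∈ → proj₁ (Reads.mem→ σ-reads γ∈) , ≤-pred (proj₂ (Reads.mem→ σ-reads γ∈))
      ; cover = λ (1≤γ , γ≤n) → Reads.mem← σ-reads (1≤γ , s≤s γ≤n) }

    open Colouring (proj₁ (block-of q₂-range))

    colouring : InC μ (map cf σ) × std μ (map cf σ) ≡ σ
    colouring = std-colours perm λ i 1≤i 1+i≤n i∼ → Reads.ordered σ-reads 1≤i (s≤s 1+i≤n) i∼

    u v : List (Fin p)
    u = map cf Pre
    v = map cf Post
    w≡ : map cf σ ≡ u ++ cf q₂ ∷ cf q₃ ∷ v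
    w≡ = map-++ cf Pre (q₂ ∷ q₃ ∷ Post)

    col-cf : ∀ {y} → 1 ≤ y × y ≤ n → col μ y ≡ just (cf y)
    col-cf y-range = inBlock-col (cf-inBlock y-range)
    cf≢ : cf q₂ ≢ cf q₃
    cf≢ eq = q₂≁q₃ (trans (col-cf q₂-range) (trans (cong just eq) (sym (col-cf q₃-range))))

    std-w′ : std μ (u ++ cf q₃ ∷ cf q₂ ∷ v) ≡ Pre ++ q₃ ∷ q₂ ∷ Post
    std-w′ = trans (proj₂ (std-transpose u v cf≢))
      (transpose-at (std μ u) (trans (length-stdAux [] u) (length-map cf Pre))
        (trans (sym (proj₁ (std-transpose u v cf≢))) (trans (cong (std μ) (sym w≡)) (proj₂ colouring))))

    φσ′≈T′ : φ n (Pre ++ q₃ ∷ q₂ ∷ Post) ≈ˢ T′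
    φσ′≈T′ = subst (_≈ˢ T′) (sym after) (≈ˢ-of-replace avoids (subst (_≈ˢ T) before φσ≈T) replace)
      where
      filled : ∀ γ → Between q₁ q₄ γ → γ ≢ q₂ → γ ≢ q₃ → γ ∈ Pre
      filled γ btw γ≢q₂ γ≢q₃ with ∈-++⁻ Pre (Q.mem← btw)
      ... | inj₁ γ∈Pre = γ∈Pre
      ... | inj₂ (here γ≡q₂) = contradiction γ≡q₂ γ≢q₂
      ... | inj₂ (there (here γ≡q₃)) = contradiction γ≡q₃ γ≢q₃
      open Transposition (transposition n Pre Post q₁<q₂ q₂<q₃ q₃<q₄ q₄≤
        (λ q₁∈ → <-irrefl refl (proj₁ (Q.mem→ (∈-++⁺ˡ q₁∈))))
        (λ q₂∈ → Unique-++⇒disjoint Pre Q.unique q₂∈ (here refl))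
        (λ q₃∈ → Unique-++⇒disjoint Pre Q.unique q₃∈ (there (here refl)))
        (λ q₄∈ → <-irrefl refl (proj₂ (Q.mem→ (∈-++⁺ˡ q₄∈))))
        filled (IsPermutation.cover perm))

    q₁≁q₂ : 1 ≤ q₁ → col μ q₁ ≢ col μ q₂
    q₁≁q₂ 1≤q₁ q₁∼q₂ with side₁₂
    ... | inj₁ refl = <⇒≱ q₁<q₃ (<⇒≤ (proj₂ simple q₁ 1≤q₁ (≤-trans q₁<q₂ (proj₂ q₂-range)) q₁∼q₂ q₃
                        (inj₂ (q₁<q₂ , q₂<q₃ , side₁₂ , side₂₃ , inj₂ (inj₂ diagonal₁₃)))))
    ... | inj₂ (inj₁ (refl , _)) = contradiction 1≤q₁ λ ()
    ... | inj₂ (inj₂ q₁q₂∈T) = proj₁ simple q₁ q₂ (cf q₁) q₁q₂∈T q₁-colour (trans (sym q₁∼q₂) q₁-colour)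
      where
      q₁-colour : col μ q₁ ≡ just (cf q₁)
      q₁-colour = col-cf (1≤q₁ , ≤-trans (<⇒≤ q₁<q₂) (proj₂ q₂-range))

    post-outside : ∀ {y} → y ∈ Post → y ≤ q₁ ⊎ q₄ ≤ y
    post-outside {y} y∈ with y ≤? q₁ | q₄ ≤? y
    ... | yes y≤q₁ | _        = inj₁ y≤q₁
    ... | no _     | yes q₄≤y = inj₂ q₄≤y
    ... | no y≰q₁  | no q₄≰y  =
      contradiction y∈ (Unique-++⇒disjoint (Pre ++ q₂ ∷ q₃ ∷ []) (Reads.unique whole)
                                           (Q.mem← (≰⇒> y≰q₁ , ≰⇒> q₄≰y)))

    post-colour : ∀ {y} → y ∈ Post → cf y <ᶠ cf q₂ ⊎ cf q₃ ≤ᶠ cf y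
    post-colour {y} y∈ with post-outside y∈
    ... | inj₂ q₄≤y = inj₂ (inBlock-≤ (cf-inBlock q₃-range) (cf-inBlock y-range) (≤-trans (<⇒≤ q₃<q₄) q₄≤y))
      where
      y-range : 1 ≤ y × y ≤ n
      y-range = IsPermutation.range perm (∈-++⁺ʳ Pre (there (there y∈)))
    ... | inj₁ y≤q₁ = inj₁ (≤∧≢⇒< (≤-trans y≤q₁ᶠ q₁≤q₂ᶠ) λ eq →
      q₁≁q₂ (proj₁ q₁-range) (trans (col-cf q₁-range)
        (trans (cong just (FP.toℕ-injective (≤-antisym q₁≤q₂ᶠ (subst (_≤ _) eq y≤q₁ᶠ)))) (sym (col-cf q₂-range)))))
      where
      y-range : 1 ≤ y × y ≤ n
      y-range = IsPermutation.range perm (∈-++⁺ʳ Pre (there (there y∈)))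
      q₁-range : 1 ≤ q₁ × q₁ ≤ n
      q₁-range = ≤-trans (proj₁ y-range) y≤q₁ , ≤-trans (<⇒≤ q₁<q₂) (proj₂ q₂-range)
      y≤q₁ᶠ : cf y ≤ᶠ cf q₁
      y≤q₁ᶠ = inBlock-≤ (cf-inBlock y-range) (cf-inBlock q₁-range) y≤q₁
      q₁≤q₂ᶠ : cf q₁ ≤ᶠ cf q₂
      q₁≤q₂ᶠ = inBlock-≤ (cf-inBlock q₁-range) (cf-inBlock q₂-range) (<⇒≤ q₁<q₂)

    readings : SwitchedReadings μ T T′
    readings =
      map cf σ , u ++ cf q₃ ∷ cf q₂ ∷ v , u , v , cf q₂ , cf q₃ ,
      (proj₁ colouring , subst (λ s → φ n s ≈ˢ T) (sym (proj₂ colouring)) φσ≈T) ,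
      ((λ c → trans (sym (count-transpose c u _ _ v)) (trans (cong (count c) (sym w≡)) (proj₁ colouring c))) ,
       subst (λ s → φ n s ≈ˢ T′) (sym std-w′) φσ′≈T′) ,
      w≡ , refl , cf≢ ,
      All-map⁺ (All.tabulate λ y∈ →
        outside-interval (inBlock-≤ (cf-inBlock q₂-range) (cf-inBlock q₃-range) (<⇒≤ q₂<q₃)) (post-colour y∈))

mainTheorem14 : ∀ (p : ℕ) (μ : Vec ℕ p) (T T' : DiagSet) →
    IsTriangulation (size μ) T → IsTriangulation (size μ) T' →
    IsSimple μ T → IsSimple μ T' →
    (SwitchedFlip μ T T' →
      ∃[ w ] ∃[ w' ] ∃[ u ] ∃[ v ] ∃[ x ] ∃[ z ]
        (IsReading μ T w × IsReading μ T' w' ×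
         w ≡ u ++ x ∷ z ∷ v × w' ≡ u ++ z ∷ x ∷ v × x ≢ z ×
         All (λ y → ¬ (x ≤ᶠ y × y <ᶠ z) × ¬ (z ≤ᶠ y × y <ᶠ x)) v))
    × ((∃[ w ] ∃[ w' ] ∃[ u ] ∃[ v ] ∃[ x ] ∃[ z ]
        (IsReading μ T w × IsReading μ T' w' ×
         w ≡ u ++ x ∷ z ∷ v × w' ≡ u ++ z ∷ x ∷ v × x ≢ z ×
         All (λ y → ¬ (x ≤ᶠ y × y <ᶠ z) × ¬ (z ≤ᶠ y × y <ᶠ x)) v))
      → SwitchedFlip μ T T')
mainTheorem14 p μ T T′ triT triT′ simT simT′ = readings-of-flip , flip-of-readings′
  where
  open Readings μ

  readings-of-flip : SwitchedFlip μ T T′ → SwitchedReadings μ T T′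
  readings-of-flip (_ , _ , _ , _ , q₁<q₂ , q₂<q₃ , q₃<q₄ , q₂≁q₃ , inj₁ (d∈T , f₁₂₃ , f₁₃₄ , r)) =
    FlipToReadings.readings triT simT q₁<q₂ q₂<q₃ q₃<q₄ q₂≁q₃ (flip-of-faces₁ d∈T f₁₂₃ f₁₃₄ r)
  readings-of-flip (_ , _ , _ , _ , q₁<q₂ , q₂<q₃ , q₃<q₄ , q₂≁q₃ , inj₂ (d∈T , f₁₂₄ , f₂₃₄ , r)) =
    SwitchedReadings-sym (FlipToReadings.readings triT′ simT′ q₁<q₂ q₂<q₃ q₃<q₄ q₂≁q₃
                            (flip-of-faces₂ triT q₁<q₂ q₂<q₃ q₃<q₄ d∈T f₁₂₄ f₂₃₄ r))

  flip-of-readings′ : SwitchedReadings μ T T′ → SwitchedFlip μ T T′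
  flip-of-readings′ (_ , _ , _ , _ , x , z , r , r′ , refl , refl , x≢z , outside) with FP.<-cmp x z
  ... | tri< x<z _ _ = proj₁ (ReadingsToFlip.flips x<z r r′ outside)
  ... | tri≈ _ x≡z _ = contradiction x≡z x≢z
  ... | tri> _ _ z<x = proj₂ (ReadingsToFlip.flips z<x r′ r (All.map Product.swap outside))
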